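{- Let $P$ and $Q$ be posets, each of which is a disjoint union of at most three pairwise incomparable chains. If $U_P=U_Q$, then $P$ and $Q$ are isomorphic.
   Context: A poset is a disjoint union of pairwise incomparable chains if its ground set is partitioned into blocks such that each block is totally ordered and elements in different blocks are incomparable. For a digraph $X=(V,E)$ with $|V|=n$, a $V$-listing is a bijection $\pi:[n]\to V$, and $X\mathrm{Des}(\pi)=\{i\in[n-1]:(\pi_i,\pi_{i+1})\in E\}$. Let $F_I=\sum_{i_1\le\dots\le i_n,\ i_j<i_{j+1}\ (j\in I)}x_{i_1}\cdots x_{i_n}$, and $U_X=\sum_\pi F_{X\mathrm{Des}(\pi)}$ over all $V$-listings. For a poset $P$, $U_P:=U_{D_P}$, where $D_P$ has the elements of $P$ as vertices and edges $(i,j)$ for all $i<_Pj$. -}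

module Defs where

open import Data.Nat as ℕ using (ℕ; zero; suc; _≤_)
open import Data.Fin using (Fin; zero; suc; toℕ)
open import Data.Fin.Properties using (all?; any?) renaming (_≟_ to _≟ᶠ_)
import Data.Fin.Properties as FinP
open import Data.List using (List; []; _∷_; map; concatMap; filter; length; allFin)
open import Data.Nat.ListAction using (sum)
open import Data.Product using (Σ; ∃; _×_; _,_)
open import Data.Sum using (_⊎_)
open import Relation.Nullary using (¬_; Dec)
open import Relation.Nullary.Decidable using (_×-dec_; _→-dec_)
open import Relation.Binary using (Rel; Decidable; IsDecStrictPartialOrder)
open import Relation.Binary.PropositionalEquality using (_≡_)
open import Function.Bundles using (_↔_; _⇔_; Inverse)

record Digraph : Set₁ where
  field
    size : ℕ
    Edge : Rel (Fin size) _
    edge? : Decidable Edge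

record FinPoset : Set₁ where
  field
    size : ℕ
    _<_ : Rel (Fin size) _
    isDSPO : IsDecStrictPartialOrder _≡_ _<_
  open IsDecStrictPartialOrder isDSPO public using (_<?_)

D : FinPoset → Digraph
D P = record { size = FinPoset.size P ; Edge = FinPoset._<_ P ; edge? = FinPoset._<?_ P }

cons : ∀ {n m} → Fin m → (Fin n → Fin m) → Fin (suc n) → Fin m
cons a f zero = a
cons a f (suc i) = f i

allFuns : (n m : ℕ) → List (Fin n → Fin m)
allFuns zero m = (λ ()) ∷ []
allFuns (suc n) m = concatMap (λ f → map (λ a → cons a f) (allFin m)) (allFuns n m)

IsListing : ∀ {n} → (Fin n → Fin n) → Set
IsListing {n} π = (∀ i j → π i ≡ π j → i ≡ j) × (∀ v → ∃ λ i → π i ≡ v)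

isListing? : ∀ {n} (π : Fin n → Fin n) → Dec (IsListing π)
isListing? π =
  all? (λ i → all? (λ j → (π i ≟ᶠ π j) →-dec (i ≟ᶠ j)))
  ×-dec all? (λ v → any? (λ i → π i ≟ᶠ v))

listings : (n : ℕ) → List (Fin n → Fin n)
listings n = filter isListing? (allFuns n n)

-- Monomials in x_1, x_2, ... : an exponent vector α : Fin k → ℕ stands for
-- x_1^{α 0} ⋯ x_k^{α (k-1)} (all later variables have exponent 0).
--
-- A term x_{i_1} ⋯ x_{i_n} of F_I is given by an index sequence
-- s : Fin n → (variable indices); it contributes to the monomial α iff
-- every index is < k and the content of s is α.

-- s is weakly increasing, and strictly increasing at positions in XDes(π):
-- position i (0-based) with i+1 < n and (π_i, π_{i+1}) ∈ E.
GoodSeq : (X : Digraph) → let n = Digraph.size X in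
          (Fin n → Fin n) → ∀ {k} → (Fin k → ℕ) → (Fin n → Fin k) → Set
GoodSeq X π {k} α s =
  (∀ i j → toℕ j ≡ suc (toℕ i) → s i Data.Fin.≤ s j)
  × (∀ i j → toℕ j ≡ suc (toℕ i) → Digraph.Edge X (π i) (π j) → s i Data.Fin.< s j)
  × (∀ v → length (filter (λ i → s i ≟ᶠ v) (allFin _)) ≡ α v)

goodSeq? : (X : Digraph) → (π : Fin (Digraph.size X) → Fin (Digraph.size X)) →
           ∀ {k} (α : Fin k → ℕ) (s : Fin (Digraph.size X) → Fin k) → Dec (GoodSeq X π α s)
goodSeq? X π α s =
  all? (λ i → all? (λ j → (toℕ j ℕ.≟ suc (toℕ i)) →-dec (s i FinP.≤? s j)))
  ×-dec all? (λ i → all? (λ j → (toℕ j ℕ.≟ suc (toℕ i)) →-dec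
                                 (Digraph.edge? X (π i) (π j) →-dec (s i FinP.<? s j))))
  ×-dec all? (λ v → length (filter (λ i → s i ≟ᶠ v) (allFin _)) ℕ.≟ α v)

-- coefficient of the monomial α in F_{XDes(π)}
coeffF : (X : Digraph) → (Fin (Digraph.size X) → Fin (Digraph.size X)) →
         ∀ {k} → (Fin k → ℕ) → ℕ
coeffF X π {k} α = length (filter (goodSeq? X π α) (allFuns (Digraph.size X) k))

coeffU : Digraph → ∀ {k} → (Fin k → ℕ) → ℕ
coeffU X α = sum (map (λ π → coeffF X π α) (listings (Digraph.size X)))

_≡U_ : Digraph → Digraph → Set
X ≡U Y = ∀ k (α : Fin k → ℕ) → coeffU X α ≡ coeffU Y α

U-eq : FinPoset → FinPoset → Set
U-eq P Q = D P ≡U D Q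

-- P is a disjoint union of k pairwise incomparable (nonempty) chains:
-- a surjective block map b : P → Fin k such that elements in the same
-- block are comparable and elements in different blocks are incomparable.

IsUnionOfChains : FinPoset → ℕ → Set
IsUnionOfChains P k = Σ (Fin (FinPoset.size P) → Fin k) λ b →
    (∀ c → ∃ λ x → b x ≡ c)
  × (∀ x y → ¬ x ≡ y → b x ≡ b y → (x < y) ⊎ (y < x))
  × (∀ x y → ¬ b x ≡ b y → ¬ (x < y))
  where open FinPoset P

UnionOfAtMostThreeChains : FinPoset → Set
UnionOfAtMostThreeChains P = ∃ λ k → k ≤ 3 × IsUnionOfChains P k

Isomorphic : FinPoset → FinPoset → Set
Isomorphic P Q = Σ (Fin (FinPoset.size P) ↔ Fin (FinPoset.size Q)) λ f →
  ∀ x y → FinPoset._<_ P x y ⇔ FinPoset._<_ Q (Inverse.to f x) (Inverse.to f y)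

module Submission where

-- U_P is a sum over the listings π of P. For a weakly increasing index sequence s, the coefficient
-- of the monomial with the content of s counts the listings π along which s increases strictly at
-- every descent of π. For s = 1,1,3,4,… and s = 1,1,1,4,… these are the listings without descent
-- among their first two, resp. three, positions. Since permutations of P act transitively on
-- injective tuples, these counts determine the number A of pairs x < y and the number C of chains
-- x < y < z (the latter by inclusion–exclusion). If P is a disjoint union of chains of lengths
-- λ₁, …, λₖ, then Σ λᵢ = |P|, Σ λᵢ² = |P| + 2A and Σ λᵢ³ = |P| + 6A + 6C. For k ≤ 3 these power
-- sums determine the multiset of the λᵢ (they are the roots of a cubic whose coefficients are given
-- by Newton's identities), and two disjoint unions of chains with the same chain lengths are
-- isomorphic.

module IntegerRoots where
  open import Data.Nat using (ℕ)
  open import Data.Integer using (ℤ; +_; 0ℤ; 1ℤ; _+_; _*_; _-_; _^_)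
  open import Data.Integer.Properties using (*-cancelˡ-≡; i*j≡0⇒i≡0∨j≡0; i-j≡0⇒i≡j)
  open import Data.Integer.Tactic.RingSolver using (solve-∀)
  open import Data.Sum using (_⊎_; inj₁; inj₂; map₂)
  open import Function using (_∘_)
  open import Relation.Binary.PropositionalEquality using (_≡_; cong₂; module ≡-Reasoning)
  open import Data.Product using (_×_; _,_; proj₁; proj₂)

  powerSum₂ : ℕ → ℤ → ℤ → ℤ
  powerSum₂ j b c = b ^ j + (c ^ j + 0ℤ)

  powerSum₃ : ℕ → ℤ → ℤ → ℤ → ℤ
  powerSum₃ j a b c = a ^ j + powerSum₂ j b c

  -- 2 (t - b) (t - c) and 6 (t - a) (t - b) (t - c), with the elementary symmetric
  -- functions of the roots expressed through their power sums (Newton's identities)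
  quadratic : ℤ → ℤ → ℤ → ℤ
  quadratic s₁ s₂ t = + 2 * (t * t) - + 2 * s₁ * t + (s₁ * s₁ - s₂)

  cubic : ℤ → ℤ → ℤ → ℤ → ℤ
  cubic s₁ s₂ s₃ t = + 6 * (t * (t * t)) - + 6 * s₁ * (t * t) + + 3 * (s₁ * s₁ - s₂) * t
                     - (s₁ * (s₁ * s₁) - + 3 * s₁ * s₂ + + 2 * s₃)

  quadratic-factors : ∀ t b c → quadratic (powerSum₂ 1 b c) (powerSum₂ 2 b c) t ≡ + 2 * ((t - b) * (t - c))
  quadratic-factors = unfolded
    where
    unfolded : ∀ t b c → let s₁ = b * 1ℤ + (c * 1ℤ + 0ℤ) ; s₂ = b * (b * 1ℤ) + (c * (c * 1ℤ) + 0ℤ) in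
               + 2 * (t * t) - + 2 * s₁ * t + (s₁ * s₁ - s₂) ≡ + 2 * ((t - b) * (t - c))
    unfolded = solve-∀

  cubic-factors : ∀ t a b c → cubic (powerSum₃ 1 a b c) (powerSum₃ 2 a b c) (powerSum₃ 3 a b c) t ≡
                              + 6 * ((t - a) * ((t - b) * (t - c)))
  cubic-factors = unfolded
    where
    unfolded : ∀ t a b c → let s₁ = a * 1ℤ + (b * 1ℤ + (c * 1ℤ + 0ℤ))
                               s₂ = a * (a * 1ℤ) + (b * (b * 1ℤ) + (c * (c * 1ℤ) + 0ℤ))
                               s₃ = a * (a * (a * 1ℤ)) + (b * (b * (b * 1ℤ)) + (c * (c * (c * 1ℤ)) + 0ℤ)) in
               + 6 * (t * (t * t)) - + 6 * s₁ * (t * t) + + 3 * (s₁ * s₁ - s₂) * t - (s₁ * (s₁ * s₁) - + 3 * s₁ * s₂ + + 2 * s₃)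
               ≡ + 6 * ((t - a) * ((t - b) * (t - c)))
    unfolded = solve-∀

  factor-root : ∀ t a {p} → (t - a) * p ≡ 0ℤ → t ≡ a ⊎ p ≡ 0ℤ
  factor-root t a {p} eq with i*j≡0⇒i≡0∨j≡0 (t - a) eq
  ... | inj₁ t-a≡0 = inj₁ (i-j≡0⇒i≡j t a t-a≡0)
  ... | inj₂ p≡0 = inj₂ p≡0

  root₂ : ∀ t c′ b c → powerSum₂ 1 t c′ ≡ powerSum₂ 1 b c → powerSum₂ 2 t c′ ≡ powerSum₂ 2 b c → t ≡ b ⊎ t ≡ c
  root₂ t c′ b c eq₁ eq₂ = map₂ (i-j≡0⇒i≡j t c) (factor-root t b (*-cancelˡ-≡ (+ 2) _ 0ℤ (begin
      + 2 * ((t - b) * (t - c))                           ≡⟨ quadratic-factors t b c ⟨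
      quadratic (powerSum₂ 1 b c) (powerSum₂ 2 b c) t     ≡⟨ cong₂ (λ s₁ s₂ → quadratic s₁ s₂ t) eq₁ eq₂ ⟨
      quadratic (powerSum₂ 1 t c′) (powerSum₂ 2 t c′) t   ≡⟨ quadratic-factors t t c′ ⟩
      + 2 * ((t - t) * (t - c′))                          ≡⟨ vanishes t c′ ⟩
      + 2 * 0ℤ                                            ∎)))
    where
    open ≡-Reasoning
    vanishes : ∀ t c′ → + 2 * ((t - t) * (t - c′)) ≡ + 2 * 0ℤ
    vanishes = solve-∀

  root₃ : ∀ t b′ c′ a b c → powerSum₃ 1 t b′ c′ ≡ powerSum₃ 1 a b c → powerSum₃ 2 t b′ c′ ≡ powerSum₃ 2 a b c →
          powerSum₃ 3 t b′ c′ ≡ powerSum₃ 3 a b c → t ≡ a ⊎ t ≡ b ⊎ t ≡ c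
  root₃ t b′ c′ a b c eq₁ eq₂ eq₃ = map₂ (map₂ (i-j≡0⇒i≡j t c) ∘ factor-root t b) (factor-root t a (*-cancelˡ-≡ (+ 6) _ 0ℤ (begin
      + 6 * ((t - a) * ((t - b) * (t - c)))
        ≡⟨ cubic-factors t a b c ⟨
      cubic (powerSum₃ 1 a b c) (powerSum₃ 2 a b c) (powerSum₃ 3 a b c) t
        ≡⟨ cong₂ (λ s₁ (s₂₃ : ℤ × ℤ) → cubic s₁ (proj₁ s₂₃) (proj₂ s₂₃) t) eq₁ (cong₂ _,_ eq₂ eq₃) ⟨
      cubic (powerSum₃ 1 t b′ c′) (powerSum₃ 2 t b′ c′) (powerSum₃ 3 t b′ c′) t
        ≡⟨ cubic-factors t t b′ c′ ⟩
      + 6 * ((t - t) * ((t - b′) * (t - c′)))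
        ≡⟨ vanishes t b′ c′ ⟩
      + 6 * 0ℤ ∎)))
    where
    open ≡-Reasoning
    vanishes : ∀ t b′ c′ → + 6 * ((t - t) * ((t - b′) * (t - c′))) ≡ + 6 * 0ℤ
    vanishes = solve-∀


open import Data.Bool.Base using (true; false)
open import Data.Empty using (⊥-elim)
open import Data.Fin as Fin using (Fin; zero; suc; toℕ)
open import Data.Fin.Patterns using (0F; 1F; 2F)
open import Data.Fin.Permutation as Perm using (Permutation′; _⟨$⟩ʳ_; _⟨$⟩ˡ_)
import Data.Fin.Properties as Finₚ
import Data.Integer as ℤ
import Data.Integer.Properties as ℤₚ
open import Data.List.Base as List using (List; []; _∷_; map; filter; length; concatMap; allFin; tabulate)
import Data.List.Properties as Listₚ
open import Data.List.Relation.Binary.Permutation.Propositional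
  using (_↭_; ↭-refl; ↭-prep; ↭-swap; ↭-trans; ↭-sym; ↭-reflexive)
open import Data.List.Relation.Binary.Permutation.Propositional.Properties using (map⁺)
open import Data.Nat as ℕ using (ℕ; zero; suc; _+_; _*_; _^_; _≤_; _<_; z≤n; s≤s; >-nonZero)
open import Data.Nat.ListAction using () renaming (sum to sumˡ)
open import Data.Nat.ListAction.Properties using (sum-++; sum-↭)
open import Data.Nat.Properties hiding (_<?_; _≤?_)
open import Data.Nat.Tactic.RingSolver using (solve-∀)
open import Data.Product using (Σ; ∃; ∃₂; _×_; _,_; proj₁; proj₂)
open import Data.Sum as Sum using (_⊎_; inj₁; inj₂; [_,_]′)
open import Function using (_∘_; id; flip)
open import Function.Bundles using (_⇔_; mk⇔; Equivalence; mk↔ₛ′)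
open import Level using (0ℓ)
open import Relation.Binary using (Rel; Decidable; IsDecStrictPartialOrder; tri<; tri≈; tri>)
open import Relation.Binary.PropositionalEquality
  using (_≡_; _≢_; refl; sym; trans; cong; cong₂; subst; subst₂; _≗_; module ≡-Reasoning)
open import Relation.Nullary using (Dec; _because_; yes; no; ¬_; contradiction)
open import Relation.Nullary.Decidable using (_×-dec_; _→-dec_; ¬?; dec-true; dec-false)

open import Algebra.Properties.CommutativeSemigroup *-commutativeSemigroup as *-CS using ()
open import Algebra.Properties.Semiring.Sum +-*-semiring
  using (sum; sum-syntax; sum-cong-≗; ∑-distrib-+; ∑-comm; *-distribˡ-sum; *-distribʳ-sum; ∑-permute)

open import Defs

𝟙 : ∀ {a} {A : Set a} → Dec A → ℕ
𝟙 (true because _) = 1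
𝟙 (false because _) = 0

module _ {a b} {A : Set a} {B : Set b} where

  𝟙-⇔ : A ⇔ B → (a? : Dec A) (b? : Dec B) → 𝟙 a? ≡ 𝟙 b?
  𝟙-⇔ _ (yes _) (yes _) = refl
  𝟙-⇔ A⇔B (yes x) (no ¬y) = contradiction (Equivalence.to A⇔B x) ¬y
  𝟙-⇔ A⇔B (no ¬x) (yes y) = contradiction (Equivalence.from A⇔B y) ¬x
  𝟙-⇔ _ (no _) (no _) = refl

  𝟙-× : (a? : Dec A) (b? : Dec B) → 𝟙 (a? ×-dec b?) ≡ 𝟙 a? * 𝟙 b?
  𝟙-× (true because _) (true because _) = refl
  𝟙-× (true because _) (false because _) = refl
  𝟙-× (false because _) _ = refl

  𝟙-mono : (A → B) → (a? : Dec A) (b? : Dec B) → 𝟙 a? ≤ 𝟙 b?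
  𝟙-mono A→B (yes x) (yes _) = ≤-refl
  𝟙-mono A→B (yes x) (no ¬y) = contradiction (A→B x) ¬y
  𝟙-mono A→B (no _) _ = z≤n


  𝟙-inclusion-exclusion : (a? : Dec A) (b? : Dec B) → 𝟙 (¬? a?) * 𝟙 (¬? b?) + (𝟙 a? + 𝟙 b?) ≡ 1 + 𝟙 a? * 𝟙 b?
  𝟙-inclusion-exclusion (true because _) (true because _) = refl
  𝟙-inclusion-exclusion (true because _) (false because _) = refl
  𝟙-inclusion-exclusion (false because _) (true because _) = refl
  𝟙-inclusion-exclusion (false because _) (false because _) = refl

module _ {a} {A : Set a} where

  𝟙-yes : (a? : Dec A) → A → 𝟙 a? ≡ 1
  𝟙-yes (yes _) _ = refl
  𝟙-yes (no ¬x) x = contradiction x ¬x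

  𝟙-no : (a? : Dec A) → ¬ A → 𝟙 a? ≡ 0
  𝟙-no (yes x) ¬x = contradiction x ¬x
  𝟙-no (no _) _ = refl

  𝟙-¬ : (a? : Dec A) → 𝟙 a? + 𝟙 (¬? a?) ≡ 1
  𝟙-¬ (true because _) = refl
  𝟙-¬ (false because _) = refl

  𝟙-positive : (a? : Dec A) → 0 < 𝟙 a? → A
  𝟙-positive (yes x) _ = x

∑-const : ∀ n c → ∑[ i < n ] c ≡ n * c
∑-const zero c = refl
∑-const (suc n) c = cong (c +_) (∑-const n c)

∑-zero : ∀ n {f : Fin n → ℕ} → (∀ i → f i ≡ 0) → ∑[ i < n ] f i ≡ 0
∑-zero n f≗0 = trans (sum-cong-≗ f≗0) (trans (∑-const n 0) (*-zeroʳ n))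

∑-δ : ∀ {n} (a : Fin n) (f : Fin n → ℕ) → ∑[ i < n ] (𝟙 (a Fin.≟ i) * f i) ≡ f a
∑-δ {suc n} zero f = begin
  f zero + 0 + ∑[ i < n ] (𝟙 (zero Fin.≟ suc i) * f (suc i))
    ≡⟨ cong (f zero + 0 +_) (∑-zero n λ i → cong (_* f (suc i)) (𝟙-no (zero Fin.≟ suc i) λ ())) ⟩
  f zero + 0 + 0
    ≡⟨ trans (+-identityʳ _) (+-identityʳ _) ⟩
  f zero ∎
  where open ≡-Reasoning
∑-δ {suc n} (suc a) f = begin
  0 + ∑[ i < n ] (𝟙 (suc a Fin.≟ suc i) * f (suc i))
    ≡⟨ sum-cong-≗ (λ i → cong (_* f (suc i)) (𝟙-⇔ (mk⇔ Finₚ.suc-injective (cong suc)) (suc a Fin.≟ suc i) (a Fin.≟ i))) ⟩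
  ∑[ i < n ] (𝟙 (a Fin.≟ i) * f (suc i))
    ≡⟨ ∑-δ a (f ∘ suc) ⟩
  f (suc a) ∎
  where open ≡-Reasoning

∑-𝟙≟ : ∀ {n} (a : Fin n) → ∑[ i < n ] 𝟙 (a Fin.≟ i) ≡ 1
∑-𝟙≟ {n} a = trans (sum-cong-≗ λ i → sym (*-identityʳ (𝟙 (a Fin.≟ i)))) (∑-δ a (λ _ → 1))

module _ {n : ℕ} where

  ∑-+-≡ : ∀ {a b} (f g : Fin n → ℕ) → ∑[ i < n ] f i ≡ a → ∑[ i < n ] g i ≡ b → ∑[ i < n ] (f i + g i) ≡ a + b
  ∑-+-≡ f g ∑f≡a ∑g≡b = trans (∑-distrib-+ f g) (cong₂ _+_ ∑f≡a ∑g≡b)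

  ∑-*-≡ : ∀ {a} c (f : Fin n → ℕ) → ∑[ i < n ] f i ≡ a → ∑[ i < n ] (c * f i) ≡ c * a
  ∑-*-≡ c f ∑f≡a = trans (sym (*-distribˡ-sum c f)) (cong (c *_) ∑f≡a)

∑-mono-≤ : ∀ n {f g : Fin n → ℕ} → (∀ i → f i ≤ g i) → ∑[ i < n ] f i ≤ ∑[ i < n ] g i
∑-mono-≤ zero f≤g = z≤n
∑-mono-≤ (suc n) f≤g = +-mono-≤ (f≤g zero) (∑-mono-≤ n (f≤g ∘ suc))

∑-mono-< : ∀ n {f g : Fin n → ℕ} → (∀ i → f i ≤ g i) → ∀ a → f a < g a → ∑[ i < n ] f i < ∑[ i < n ] g i
∑-mono-< (suc n) f≤g zero fa<ga = +-mono-<-≤ fa<ga (∑-mono-≤ n (f≤g ∘ suc))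
∑-mono-< (suc n) f≤g (suc a) fa<ga = +-mono-≤-< (f≤g zero) (∑-mono-< n (f≤g ∘ suc) a fa<ga)

term≤∑ : ∀ n (f : Fin n → ℕ) a → f a ≤ ∑[ i < n ] f i
term≤∑ (suc n) f zero = m≤m+n (f zero) _
term≤∑ (suc n) f (suc a) = ≤-trans (term≤∑ n (f ∘ suc) a) (m≤n+m _ (f zero))

∑-positive : ∀ n (f : Fin n → ℕ) → 0 < ∑[ i < n ] f i → ∃ λ i → 0 < f i
∑-positive (suc n) f 0<∑ with f zero in eq
... | suc _ = zero , subst (0 <_) (sym eq) (s≤s z≤n)
... | zero with ∑-positive n (f ∘ suc) 0<∑
...   | i , 0<fi = suc i , 0<fi

∑≡n⇒all≡1 : ∀ n (f : Fin n → ℕ) → (∀ i → f i ≤ 1) → ∑[ i < n ] f i ≡ n → ∀ i → f i ≡ 1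
∑≡n⇒all≡1 (suc n) f f≤1 ∑≡n = λ where
    zero → f₀≡1
    (suc i) → ∑≡n⇒all≡1 n (f ∘ suc) (f≤1 ∘ suc) rest≡n i
  where
  rest≤n : ∑[ i < n ] f (suc i) ≤ n
  rest≤n = ≤-trans (∑-mono-≤ n (f≤1 ∘ suc)) (≤-reflexive (trans (∑-const n 1) (*-identityʳ n)))
  f₀≡1 : f zero ≡ 1
  f₀≡1 = ≤-antisym (f≤1 zero) (+-cancelʳ-≤ n 1 (f zero) (≤-trans (≤-reflexive (sym ∑≡n)) (+-monoʳ-≤ (f zero) rest≤n)))
  rest≡n : ∑[ i < n ] f (suc i) ≡ n
  rest≡n = suc-injective (trans (cong (_+ ∑[ i < n ] f (suc i)) (sym f₀≡1)) ∑≡n)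

∑-𝟙-unique : ∀ n {p} {P : Fin n → Set p} (P? : ∀ i → Dec (P i)) → (∀ i j → P i → P j → i ≡ j) →
             ∑[ i < n ] 𝟙 (P? i) ≤ 1
∑-𝟙-unique zero P? unique = z≤n
∑-𝟙-unique (suc n) P? unique with P? zero
... | yes p₀ = ≤-reflexive (cong suc (∑-zero n λ i → 𝟙-no (P? (suc i)) λ pᵢ → Finₚ.0≢1+n (unique zero (suc i) p₀ pᵢ)))
... | no _ = ∑-𝟙-unique n (P? ∘ suc) (λ i j pᵢ pⱼ → Finₚ.suc-injective (unique (suc i) (suc j) pᵢ pⱼ))

module _ {a} {A : Set a} where

  sumˡ-map-cong : {g h : A → ℕ} → (∀ x → g x ≡ h x) → ∀ xs → sumˡ (map g xs) ≡ sumˡ (map h xs)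
  sumˡ-map-cong g≗h xs = cong sumˡ (Listₚ.map-cong g≗h xs)

  sumˡ-map-concatMap : ∀ {b} {B : Set b} (h : A → List B) (g : B → ℕ) xs →
                       sumˡ (map g (concatMap h xs)) ≡ sumˡ (map (λ x → sumˡ (map g (h x))) xs)
  sumˡ-map-concatMap h g [] = refl
  sumˡ-map-concatMap h g (x ∷ xs) = begin
    sumˡ (map g (h x List.++ concatMap h xs))              ≡⟨ cong sumˡ (Listₚ.map-++ g (h x) _) ⟩
    sumˡ (map g (h x) List.++ map g (concatMap h xs))      ≡⟨ sum-++ (map g (h x)) _ ⟩
    sumˡ (map g (h x)) + sumˡ (map g (concatMap h xs))     ≡⟨ cong (sumˡ (map g (h x)) +_) (sumˡ-map-concatMap h g xs) ⟩
    sumˡ (map g (h x)) + sumˡ (map (λ y → sumˡ (map g (h y))) xs) ∎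
    where open ≡-Reasoning

  sumˡ-map-tabulate : ∀ {n} (f : A → ℕ) (g : Fin n → A) → sumˡ (map f (tabulate g)) ≡ ∑[ i < n ] f (g i)
  sumˡ-map-tabulate {zero} f g = refl
  sumˡ-map-tabulate {suc n} f g = cong (f (g zero) +_) (sumˡ-map-tabulate f (g ∘ suc))

  module _ {p} {P : A → Set p} (P? : ∀ x → Dec (P x)) where

    sumˡ-map-filter : (g : A → ℕ) → ∀ xs → sumˡ (map g (filter P? xs)) ≡ sumˡ (map (λ x → 𝟙 (P? x) * g x) xs)
    sumˡ-map-filter g [] = refl
    sumˡ-map-filter g (x ∷ xs) with P? x
    ... | yes _ = cong₂ _+_ (sym (+-identityʳ (g x))) (sumˡ-map-filter g xs)
    ... | no _ = sumˡ-map-filter g xs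

    length-filter : ∀ xs → length (filter P? xs) ≡ sumˡ (map (𝟙 ∘ P?) xs)
    length-filter [] = refl
    length-filter (x ∷ xs) with P? x
    ... | yes _ = cong suc (length-filter xs)
    ... | no _ = length-filter xs

infix 4 _≗?_

_≗?_ : ∀ {r n} (f g : Fin r → Fin n) → Dec (f ≗ g)
f ≗? g = Finₚ.all? λ i → f i Fin.≟ g i

Extensional : ∀ {r n} → ((Fin r → Fin n) → ℕ) → Set
Extensional g = ∀ {f f′} → f ≗ f′ → g f ≡ g f′

module _ {r n : ℕ} where

  cons-η : (f : Fin (suc r) → Fin n) → cons (f zero) (f ∘ suc) ≗ f
  cons-η f zero = refl
  cons-η f (suc i) = refl

  cons-cong : (a : Fin n) {f f′ : Fin r → Fin n} → f ≗ f′ → cons a f ≗ cons a f′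
  cons-cong a f≗f′ zero = refl
  cons-cong a f≗f′ (suc i) = f≗f′ i

  ≗-cons⇔ : (f : Fin (suc r) → Fin n) (a : Fin n) (t : Fin r → Fin n) → f ≗ cons a t ⇔ (f zero ≡ a × f ∘ suc ≗ t)
  ≗-cons⇔ f a t = mk⇔ (λ f≗ → f≗ zero , f≗ ∘ suc) λ where (f₀≡a , f∘suc≗t) zero → f₀≡a
                                                          (f₀≡a , f∘suc≗t) (suc i) → f∘suc≗t i

  extensional-∘cons : (g : (Fin (suc r) → Fin n) → ℕ) → Extensional g → (a : Fin n) → Extensional (g ∘ cons a)
  extensional-∘cons g ext a f≗f′ = ext (cons-cong a f≗f′)

∑ᶠ : ∀ r n → ((Fin r → Fin n) → ℕ) → ℕ
∑ᶠ zero n g = g (λ ())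
∑ᶠ (suc r) n g = ∑ᶠ r n (λ f → ∑[ a < n ] g (cons a f))

sumˡ-allFuns : ∀ r n (g : (Fin r → Fin n) → ℕ) → sumˡ (map g (allFuns r n)) ≡ ∑ᶠ r n g
sumˡ-allFuns zero n g = +-identityʳ (g (λ ()))
sumˡ-allFuns (suc r) n g = begin
  sumˡ (map g (concatMap (λ f → map (λ a → cons a f) (allFin n)) (allFuns r n)))
    ≡⟨ sumˡ-map-concatMap _ g (allFuns r n) ⟩
  sumˡ (map (λ f → sumˡ (map g (map (λ a → cons a f) (allFin n)))) (allFuns r n))
    ≡⟨ sumˡ-map-cong (λ f → trans (cong sumˡ (sym (Listₚ.map-∘ (allFin n)))) (sumˡ-map-tabulate (g ∘ flip cons f) id)) (allFuns r n) ⟩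
  sumˡ (map (λ f → ∑[ a < n ] g (cons a f)) (allFuns r n))
    ≡⟨ sumˡ-allFuns r n _ ⟩
  ∑ᶠ (suc r) n g ∎
  where open ≡-Reasoning

module _ {n : ℕ} where

  ∑ᶠ-cong : ∀ r {g h : (Fin r → Fin n) → ℕ} → (∀ f → g f ≡ h f) → ∑ᶠ r n g ≡ ∑ᶠ r n h
  ∑ᶠ-cong zero g≗h = g≗h _
  ∑ᶠ-cong (suc r) g≗h = ∑ᶠ-cong r λ f → sum-cong-≗ λ a → g≗h (cons a f)

  ∑ᶠ-+ : ∀ r (g h : (Fin r → Fin n) → ℕ) → ∑ᶠ r n (λ f → g f + h f) ≡ ∑ᶠ r n g + ∑ᶠ r n h
  ∑ᶠ-+ zero g h = refl
  ∑ᶠ-+ (suc r) g h = trans (∑ᶠ-cong r λ f → ∑-distrib-+ (g ∘ flip cons f) (h ∘ flip cons f)) (∑ᶠ-+ r _ _)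

  *-distribˡ-∑ᶠ : ∀ r c (g : (Fin r → Fin n) → ℕ) → c * ∑ᶠ r n g ≡ ∑ᶠ r n (λ f → c * g f)
  *-distribˡ-∑ᶠ zero c g = refl
  *-distribˡ-∑ᶠ (suc r) c g = trans (*-distribˡ-∑ᶠ r c _) (∑ᶠ-cong r λ f → *-distribˡ-sum c (g ∘ flip cons f))

  ∑ᶠ-zero : ∀ r {g : (Fin r → Fin n) → ℕ} → (∀ f → g f ≡ 0) → ∑ᶠ r n g ≡ 0
  ∑ᶠ-zero r g≗0 = trans (∑ᶠ-cong r g≗0) (sym (*-distribˡ-∑ᶠ r 0 (λ _ → 0)))

  ∑ᶠ-∑ : ∀ r m (g : Fin m → (Fin r → Fin n) → ℕ) → ∑ᶠ r n (λ f → ∑[ i < m ] g i f) ≡ ∑[ i < m ] ∑ᶠ r n (g i)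
  ∑ᶠ-∑ zero m g = refl
  ∑ᶠ-∑ (suc r) m g = trans (∑ᶠ-cong r λ f → ∑-comm λ a i → g i (cons a f)) (∑ᶠ-∑ r m _)

∑ᶠ-comm : ∀ r n r′ n′ (g : (Fin r → Fin n) → (Fin r′ → Fin n′) → ℕ) →
          ∑ᶠ r n (λ f → ∑ᶠ r′ n′ (g f)) ≡ ∑ᶠ r′ n′ (λ f′ → ∑ᶠ r n (λ f → g f f′))
∑ᶠ-comm zero n r′ n′ g = refl
∑ᶠ-comm (suc r) n r′ n′ g = begin
  ∑ᶠ r n (λ f → ∑[ a < n ] ∑ᶠ r′ n′ (g (cons a f)))
    ≡⟨ ∑ᶠ-cong r (λ f → sym (∑ᶠ-∑ r′ n (λ a → g (cons a f)))) ⟩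
  ∑ᶠ r n (λ f → ∑ᶠ r′ n′ (λ f′ → ∑[ a < n ] g (cons a f) f′))
    ≡⟨ ∑ᶠ-comm r n r′ n′ _ ⟩
  ∑ᶠ r′ n′ (λ f′ → ∑ᶠ (suc r) n (λ f → g f f′)) ∎
  where open ≡-Reasoning

∑ᶠ-δ : ∀ r n (f : Fin r → Fin n) (g : (Fin r → Fin n) → ℕ) → Extensional g →
       ∑ᶠ r n (λ t → 𝟙 (f ≗? t) * g t) ≡ g f
∑ᶠ-δ zero n f g ext = trans (+-identityʳ _) (ext λ ())
∑ᶠ-δ (suc r) n f g ext = begin
  ∑ᶠ r n (λ t → ∑[ a < n ] (𝟙 (f ≗? cons a t) * g (cons a t)))
    ≡⟨ ∑ᶠ-cong r (λ t → sum-cong-≗ λ a → split t a) ⟩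
  ∑ᶠ r n (λ t → ∑[ a < n ] (𝟙 (f zero Fin.≟ a) * (𝟙 (f ∘ suc ≗? t) * g (cons a t))))
    ≡⟨ ∑ᶠ-cong r (λ t → ∑-δ (f zero) _) ⟩
  ∑ᶠ r n (λ t → 𝟙 (f ∘ suc ≗? t) * g (cons (f zero) t))
    ≡⟨ ∑ᶠ-δ r n (f ∘ suc) _ (extensional-∘cons g ext (f zero)) ⟩
  g (cons (f zero) (f ∘ suc))
    ≡⟨ ext (cons-η f) ⟩
  g f ∎
  where
  open ≡-Reasoning
  split : ∀ t a → 𝟙 (f ≗? cons a t) * g (cons a t) ≡ 𝟙 (f zero Fin.≟ a) * (𝟙 (f ∘ suc ≗? t) * g (cons a t))
  split t a = begin
    𝟙 (f ≗? cons a t) * g (cons a t)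
      ≡⟨ cong (_* g (cons a t)) (𝟙-⇔ (≗-cons⇔ f a t) (f ≗? cons a t) (f zero Fin.≟ a ×-dec f ∘ suc ≗? t)) ⟩
    𝟙 (f zero Fin.≟ a ×-dec f ∘ suc ≗? t) * g (cons a t)
      ≡⟨ cong (_* g (cons a t)) (𝟙-× (f zero Fin.≟ a) (f ∘ suc ≗? t)) ⟩
    𝟙 (f zero Fin.≟ a) * 𝟙 (f ∘ suc ≗? t) * g (cons a t)
      ≡⟨ *-assoc (𝟙 (f zero Fin.≟ a)) _ _ ⟩
    𝟙 (f zero Fin.≟ a) * (𝟙 (f ∘ suc ≗? t) * g (cons a t)) ∎

term≤∑ᶠ : ∀ r n (g : (Fin r → Fin n) → ℕ) → Extensional g → ∀ f → g f ≤ ∑ᶠ r n g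
term≤∑ᶠ zero n g ext f = ≤-reflexive (ext λ ())
term≤∑ᶠ (suc r) n g ext f = begin
  g f                                            ≡⟨ ext (cons-η f) ⟨
  g (cons (f zero) (f ∘ suc))                    ≤⟨ term≤∑ n (λ a → g (cons a (f ∘ suc))) (f zero) ⟩
  ∑[ a < n ] g (cons a (f ∘ suc))                ≤⟨ term≤∑ᶠ r n _ (λ f≗f′ → sum-cong-≗ λ a → ext (cons-cong a f≗f′)) (f ∘ suc) ⟩
  ∑ᶠ (suc r) n g                                 ∎
  where open ≤-Reasoning

∑ᶠ-∘-permutation : ∀ r n (σ : Permutation′ n) (g : (Fin r → Fin n) → ℕ) → Extensional g →
                   ∑ᶠ r n (λ f → g ((σ ⟨$⟩ʳ_) ∘ f)) ≡ ∑ᶠ r n g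
∑ᶠ-∘-permutation zero n σ g ext = ext λ ()
∑ᶠ-∘-permutation (suc r) n σ g ext = begin
  ∑ᶠ r n (λ f → ∑[ a < n ] g ((σ ⟨$⟩ʳ_) ∘ cons a f))
    ≡⟨ ∑ᶠ-cong r (λ f → sum-cong-≗ λ a → ext (σ∘cons a f)) ⟩
  ∑ᶠ r n (λ f → ∑[ a < n ] g (cons (σ ⟨$⟩ʳ a) ((σ ⟨$⟩ʳ_) ∘ f)))
    ≡⟨ ∑ᶠ-∘-permutation r n σ _ (λ f≗f′ → sum-cong-≗ λ a → ext (cons-cong (σ ⟨$⟩ʳ a) f≗f′)) ⟩
  ∑ᶠ r n (λ f → ∑[ a < n ] g (cons (σ ⟨$⟩ʳ a) f))
    ≡⟨ ∑ᶠ-cong r (λ f → sym (∑-permute (λ a → g (cons a f)) σ)) ⟩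
  ∑ᶠ (suc r) n g ∎
  where
  open ≡-Reasoning
  σ∘cons : ∀ a f → (σ ⟨$⟩ʳ_) ∘ cons a f ≗ cons (σ ⟨$⟩ʳ a) ((σ ⟨$⟩ʳ_) ∘ f)
  σ∘cons a f zero = refl
  σ∘cons a f (suc i) = refl

listingSum : ∀ n → ((Fin n → Fin n) → ℕ) → ℕ
listingSum n g = ∑ᶠ n n (λ π → 𝟙 (isListing? π) * g π)

sumˡ-listings : ∀ n (g : (Fin n → Fin n) → ℕ) → sumˡ (map g (listings n)) ≡ listingSum n g
sumˡ-listings n g = trans (sumˡ-map-filter isListing? g (allFuns n n)) (sumˡ-allFuns n n _)

module _ {n : ℕ} where

  listingSum-cong : {g h : (Fin n → Fin n) → ℕ} → (∀ π → IsListing π → g π ≡ h π) → listingSum n g ≡ listingSum n h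
  listingSum-cong {g} {h} g≗h = ∑ᶠ-cong n λ π → on π (isListing? π)
    where
    on : ∀ π (l? : Dec (IsListing π)) → 𝟙 l? * g π ≡ 𝟙 l? * h π
    on π (yes l) = cong (_+ 0) (g≗h π l)
    on π (no _) = refl

  listingSum-+ : (g h : (Fin n → Fin n) → ℕ) → listingSum n (λ π → g π + h π) ≡ listingSum n g + listingSum n h
  listingSum-+ g h = trans (∑ᶠ-cong n λ π → *-distribˡ-+ (𝟙 (isListing? π)) (g π) (h π)) (∑ᶠ-+ n _ _)

  *-distribˡ-listingSum : ∀ c (g : (Fin n → Fin n) → ℕ) → c * listingSum n g ≡ listingSum n (λ π → c * g π)
  *-distribˡ-listingSum c g = trans (*-distribˡ-∑ᶠ n c _) (∑ᶠ-cong n λ π → *-CS.x∙yz≈y∙xz c (𝟙 (isListing? π)) (g π))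

  listingSum-∑ᶠ : ∀ r m (g : (Fin n → Fin n) → (Fin r → Fin m) → ℕ) →
                  listingSum n (λ π → ∑ᶠ r m (g π)) ≡ ∑ᶠ r m (λ t → listingSum n (λ π → g π t))
  listingSum-∑ᶠ r m g = trans (∑ᶠ-cong n λ π → *-distribˡ-∑ᶠ r (𝟙 (isListing? π)) (g π)) (∑ᶠ-comm n n r m _)

  isListing-cong : {π π′ : Fin n → Fin n} → π ≗ π′ → IsListing π → IsListing π′
  isListing-cong π≗π′ (inj , surj) =
    (λ i j eq → inj i j (trans (π≗π′ i) (trans eq (sym (π≗π′ j))))) ,
    (λ v → let i , πi≡v = surj v in i , trans (sym (π≗π′ i)) πi≡v)

  isListing-id : IsListing {n} id
  isListing-id = (λ i j eq → eq) , λ v → v , refl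

  extensional-listingSummand : (g : (Fin n → Fin n) → ℕ) → Extensional g → Extensional (λ π → 𝟙 (isListing? π) * g π)
  extensional-listingSummand g ext π≗π′ =
    cong₂ _*_ (𝟙-⇔ (mk⇔ (isListing-cong π≗π′) (isListing-cong (sym ∘ π≗π′))) (isListing? _) (isListing? _)) (ext π≗π′)

  term≤listingSum : (g : (Fin n → Fin n) → ℕ) → Extensional g → g id ≤ listingSum n g
  term≤listingSum g ext = begin
    g id                         ≡⟨ trans (cong (_* g id) (𝟙-yes (isListing? {n} id) isListing-id)) (+-identityʳ (g id)) ⟨
    𝟙 (isListing? {n} id) * g id  ≤⟨ term≤∑ᶠ n n (λ π → 𝟙 (isListing? π) * g π) (extensional-listingSummand g ext) id ⟩
    listingSum n g               ∎
    where open ≤-Reasoning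

  ⟨$⟩ʳ-injective : (σ : Permutation′ n) {x y : Fin n} → σ ⟨$⟩ʳ x ≡ σ ⟨$⟩ʳ y → x ≡ y
  ⟨$⟩ʳ-injective σ {x} {y} eq = trans (sym (Perm.inverseˡ σ)) (trans (cong (σ ⟨$⟩ˡ_) eq) (Perm.inverseˡ σ))

  isListing-∘⇔ : (σ : Permutation′ n) (π : Fin n → Fin n) → IsListing π ⇔ IsListing ((σ ⟨$⟩ʳ_) ∘ π)
  isListing-∘⇔ σ π = mk⇔
    (λ (inj , surj) → (λ i j eq → inj i j (⟨$⟩ʳ-injective σ eq)) ,
                      (λ v → let i , πi≡ = surj (σ ⟨$⟩ˡ v) in i , trans (cong (σ ⟨$⟩ʳ_) πi≡) (Perm.inverseʳ σ)))
    (λ (inj , surj) → (λ i j eq → inj i j (cong (σ ⟨$⟩ʳ_) eq)) ,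
                      (λ v → let i , σπi≡ = surj (σ ⟨$⟩ʳ v) in i , ⟨$⟩ʳ-injective σ σπi≡))

  listingSum-∘-permutation : (σ : Permutation′ n) (g : (Fin n → Fin n) → ℕ) → Extensional g →
                             listingSum n (λ π → g ((σ ⟨$⟩ʳ_) ∘ π)) ≡ listingSum n g
  listingSum-∘-permutation σ g ext = begin
    ∑ᶠ n n (λ π → 𝟙 (isListing? π) * g ((σ ⟨$⟩ʳ_) ∘ π))
      ≡⟨ ∑ᶠ-cong n (λ π → cong (_* g ((σ ⟨$⟩ʳ_) ∘ π))
                              (𝟙-⇔ (isListing-∘⇔ σ π) (isListing? π) (isListing? ((σ ⟨$⟩ʳ_) ∘ π)))) ⟩
    ∑ᶠ n n (λ π → 𝟙 (isListing? ((σ ⟨$⟩ʳ_) ∘ π)) * g ((σ ⟨$⟩ʳ_) ∘ π))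
      ≡⟨ ∑ᶠ-∘-permutation n n σ _ (extensional-listingSummand g ext) ⟩
    listingSum n g ∎
    where open ≡-Reasoning

IsInjective : ∀ {r n} → (Fin r → Fin n) → Set
IsInjective t = ∀ i j → t i ≡ t j → i ≡ j

injective? : ∀ {r n} (t : Fin r → Fin n) → Dec (IsInjective t)
injective? t = Finₚ.all? λ i → Finₚ.all? λ j → t i Fin.≟ t j →-dec i Fin.≟ j

module _ {n : ℕ} (i j : Fin n) where

  transpose-source : Perm.transpose i j ⟨$⟩ʳ i ≡ j
  transpose-source rewrite dec-true (i Fin.≟ i) refl = refl

  transpose-fixes : ∀ {k} → k ≢ i → k ≢ j → Perm.transpose i j ⟨$⟩ʳ k ≡ k
  transpose-fixes {k} k≢i k≢j rewrite dec-false (k Fin.≟ i) k≢i | dec-false (k Fin.≟ j) k≢j = refl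

permutation-carrying : ∀ {r n} (t z : Fin r → Fin n) → IsInjective t → IsInjective z →
                       Σ (Permutation′ n) λ σ → ∀ i → σ ⟨$⟩ʳ t i ≡ z i
permutation-carrying {zero} t z _ _ = Perm.id , λ ()
permutation-carrying {suc r} {n} t z t-inj z-inj = σ′ Perm.∘ₚ Perm.transpose u (z zero) , carries
  where
  tail-carried : Σ (Permutation′ n) λ σ → ∀ i → σ ⟨$⟩ʳ t (suc i) ≡ z (suc i)
  tail-carried = permutation-carrying (t ∘ suc) (z ∘ suc)
                   (λ i j eq → Finₚ.suc-injective (t-inj (suc i) (suc j) eq))
                   (λ i j eq → Finₚ.suc-injective (z-inj (suc i) (suc j) eq))
  σ′ : Permutation′ n
  σ′ = proj₁ tail-carried
  u : Fin n
  u = σ′ ⟨$⟩ʳ t zero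
  carries : ∀ i → Perm.transpose u (z zero) ⟨$⟩ʳ (σ′ ⟨$⟩ʳ t i) ≡ z i
  carries zero = transpose-source u (z zero)
  carries (suc i) = trans (cong (Perm.transpose u (z zero) ⟨$⟩ʳ_) σ′tᵢ≡zᵢ) (transpose-fixes u (z zero) zᵢ≢u zᵢ≢z₀)
    where
    σ′tᵢ≡zᵢ : σ′ ⟨$⟩ʳ t (suc i) ≡ z (suc i)
    σ′tᵢ≡zᵢ = proj₂ tail-carried i
    zᵢ≢u : z (suc i) ≢ u
    zᵢ≢u eq = Finₚ.0≢1+n (t-inj zero (suc i) (⟨$⟩ʳ-injective σ′ (trans (sym eq) (sym σ′tᵢ≡zᵢ))))
    zᵢ≢z₀ : z (suc i) ≢ z zero
    zᵢ≢z₀ eq = Finₚ.0≢1+n (z-inj zero (suc i) (sym eq))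

listingSum-zero : ∀ {n} (g : (Fin n → Fin n) → ℕ) → (∀ π → IsListing π → g π ≡ 0) → listingSum n g ≡ 0
listingSum-zero {n} g g≗0 = trans (listingSum-cong g≗0) (∑ᶠ-zero n λ π → *-zeroʳ (𝟙 (isListing? π)))

-- Every injective tuple of entries occupies the positions z in the same number fiberSize of
-- listings: a permutation carrying one tuple to another maps the corresponding listings bijectively.
module Positions {r n : ℕ} (z : Fin r → Fin n) (z-inj : IsInjective z) where

  fiberIndicator : (Fin r → Fin n) → (Fin n → Fin n) → ℕ
  fiberIndicator t π = 𝟙 (π ∘ z ≗? t)

  fiberSize : ℕ
  fiberSize = listingSum n (fiberIndicator z)

  extensional-fiberIndicator : ∀ t → Extensional (fiberIndicator t)
  extensional-fiberIndicator t {π} {π′} π≗π′ = 𝟙-⇔ (mk⇔ (λ eq i → trans (sym (π≗π′ (z i))) (eq i))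
                                                        (λ eq i → trans (π≗π′ (z i)) (eq i)))
                                                   (π ∘ z ≗? t) (π′ ∘ z ≗? t)

  fiberSize-positive : 0 < fiberSize
  fiberSize-positive = ≤-trans (≤-reflexive (sym (𝟙-yes (z ≗? z) λ _ → refl)))
                               (term≤listingSum (fiberIndicator z) (extensional-fiberIndicator z))

  listingSum-fiber : ∀ t → listingSum n (fiberIndicator t) ≡ 𝟙 (injective? t) * fiberSize
  listingSum-fiber t with injective? t
  ... | no ¬t-inj = listingSum-zero _ λ π (π-inj , _) → 𝟙-no (π ∘ z ≗? t) λ π∘z≗t →
          ¬t-inj λ i j tᵢ≡tⱼ → z-inj i j (π-inj (z i) (z j) (trans (π∘z≗t i) (trans tᵢ≡tⱼ (sym (π∘z≗t j)))))
  ... | yes t-inj = begin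
    listingSum n (fiberIndicator t)
      ≡⟨ listingSum-cong (λ π _ → 𝟙-⇔ (carry π) (π ∘ z ≗? t) ((σ ⟨$⟩ʳ_) ∘ π ∘ z ≗? z)) ⟩
    listingSum n (λ π → fiberIndicator z ((σ ⟨$⟩ʳ_) ∘ π))
      ≡⟨ listingSum-∘-permutation σ (fiberIndicator z) (extensional-fiberIndicator z) ⟩
    fiberSize
      ≡⟨ +-identityʳ fiberSize ⟨
    1 * fiberSize ∎
    where
    open ≡-Reasoning
    σ : Permutation′ n
    σ = proj₁ (permutation-carrying t z t-inj z-inj)
    σt≡z : ∀ i → σ ⟨$⟩ʳ t i ≡ z i
    σt≡z = proj₂ (permutation-carrying t z t-inj z-inj)
    carry : ∀ π → π ∘ z ≗ t ⇔ (σ ⟨$⟩ʳ_) ∘ π ∘ z ≗ z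
    carry π = mk⇔ (λ eq i → trans (cong (σ ⟨$⟩ʳ_) (eq i)) (σt≡z i))
                  (λ eq i → ⟨$⟩ʳ-injective σ (trans (eq i) (sym (σt≡z i))))

  listingSum-∘positions : (R : (Fin r → Fin n) → ℕ) → Extensional R →
                          listingSum n (λ π → R (π ∘ z)) ≡ fiberSize * ∑ᶠ r n (λ t → 𝟙 (injective? t) * R t)
  listingSum-∘positions R ext = begin
    listingSum n (λ π → R (π ∘ z))
      ≡⟨ listingSum-cong (λ π _ → sym (∑ᶠ-δ r n (π ∘ z) R ext)) ⟩
    listingSum n (λ π → ∑ᶠ r n (λ t → fiberIndicator t π * R t))
      ≡⟨ listingSum-∑ᶠ r n (λ π t → fiberIndicator t π * R t) ⟩
    ∑ᶠ r n (λ t → listingSum n (λ π → fiberIndicator t π * R t))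
      ≡⟨ ∑ᶠ-cong r (λ t → listingSum-*ʳ (fiberIndicator t) (R t)) ⟩
    ∑ᶠ r n (λ t → listingSum n (fiberIndicator t) * R t)
      ≡⟨ ∑ᶠ-cong r (λ t → cong (_* R t) (trans (listingSum-fiber t) (*-comm (𝟙 (injective? t)) fiberSize))) ⟩
    ∑ᶠ r n (λ t → fiberSize * 𝟙 (injective? t) * R t)
      ≡⟨ ∑ᶠ-cong r (λ t → *-assoc fiberSize (𝟙 (injective? t)) (R t)) ⟩
    ∑ᶠ r n (λ t → fiberSize * (𝟙 (injective? t) * R t))
      ≡⟨ *-distribˡ-∑ᶠ r fiberSize _ ⟨
    fiberSize * ∑ᶠ r n (λ t → 𝟙 (injective? t) * R t) ∎
    where
    open ≡-Reasoning
    listingSum-*ʳ : (g : (Fin n → Fin n) → ℕ) (c : ℕ) → listingSum n (λ π → g π * c) ≡ listingSum n g * c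
    listingSum-*ʳ g c = begin
      listingSum n (λ π → g π * c)  ≡⟨ listingSum-cong (λ π _ → *-comm (g π) c) ⟩
      listingSum n (λ π → c * g π)  ≡⟨ *-distribˡ-listingSum c g ⟨
      c * listingSum n g            ≡⟨ *-comm c _ ⟩
      listingSum n g * c            ∎

  listingSums≡⇒tupleSums≡ : (R R′ : (Fin r → Fin n) → ℕ) → Extensional R → Extensional R′ →
                     listingSum n (λ π → R (π ∘ z)) ≡ listingSum n (λ π → R′ (π ∘ z)) →
                     ∑ᶠ r n (λ t → 𝟙 (injective? t) * R t) ≡ ∑ᶠ r n (λ t → 𝟙 (injective? t) * R′ t)
  listingSums≡⇒tupleSums≡ R R′ ext ext′ eq = *-cancelˡ-≡ _ _ fiberSize {{>-nonZero fiberSize-positive}}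
    (trans (sym (listingSum-∘positions R ext)) (trans eq (listingSum-∘positions R′ ext′)))

count : ∀ {n k} → (Fin n → Fin k) → Fin k → ℕ
count {n} s v = ∑[ i < n ] 𝟙 (s i Fin.≟ v)

content : ∀ {n k} → (Fin n → Fin k) → Fin k → ℕ
content {n} s v = length (filter (λ i → s i Fin.≟ v) (allFin n))

content≡count : ∀ {n k} (s : Fin n → Fin k) v → content s v ≡ count s v
content≡count {n} s v = trans (length-filter (λ i → s i Fin.≟ v) (allFin n)) (sumˡ-map-tabulate (λ i → 𝟙 (s i Fin.≟ v)) id)

count-cong : ∀ {n k} {s t : Fin n → Fin k} → s ≗ t → ∀ v → count s v ≡ count t v
count-cong {s = s} {t} s≗t v = sum-cong-≗ λ i → 𝟙-⇔ (mk⇔ (trans (sym (s≗t i))) (trans (s≗t i))) (s i Fin.≟ v) (t i Fin.≟ v)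

WeaklyIncreasing : ∀ {n k} → (Fin n → Fin k) → Set
WeaklyIncreasing s = ∀ i j → toℕ j ≡ suc (toℕ i) → s i Fin.≤ s j

<-adjacent : ∀ {n} {i j : Fin n} → toℕ j ≡ suc (toℕ i) → i Fin.< j
<-adjacent j≡1+i = ≤-reflexive (sym j≡1+i)

weaklyIncreasing-tail : ∀ {n k} {s : Fin (suc n) → Fin k} → WeaklyIncreasing s → WeaklyIncreasing (s ∘ suc)
weaklyIncreasing-tail s↑ i j j≡1+i = s↑ (suc i) (suc j) (cong suc j≡1+i)

weaklyIncreasing-head≤ : ∀ {n k} {s : Fin (suc n) → Fin k} → WeaklyIncreasing s → ∀ i → s zero Fin.≤ s i
weaklyIncreasing-head≤ s↑ zero = ≤-refl
weaklyIncreasing-head≤ {suc n} s↑ (suc i) =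
  ≤-trans (s↑ zero (suc zero) refl) (weaklyIncreasing-head≤ (weaklyIncreasing-tail s↑) i)

-- If s₀ < t₀, the value s₀ occurs in s but not in t.
weaklyIncreasing-head-≤ : ∀ {n k} (s t : Fin (suc n) → Fin k) → WeaklyIncreasing t →
                           (∀ v → count s v ≡ count t v) → t zero Fin.≤ s zero
weaklyIncreasing-head-≤ {n} s t t↑ same with t zero Finₚ.≤? s zero
... | yes t₀≤s₀ = t₀≤s₀
... | no t₀≰s₀ = contradiction (≤-trans count-s-positive (≤-reflexive (trans (same (s zero)) count-t≡0))) λ ()
  where
  count-s-positive : 1 ≤ count s (s zero)
  count-s-positive = ≤-trans (≤-reflexive (sym (𝟙-yes (s zero Fin.≟ s zero) refl)))
                             (term≤∑ (suc n) (λ i → 𝟙 (s i Fin.≟ s zero)) zero)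
  count-t≡0 : count t (s zero) ≡ 0
  count-t≡0 = ∑-zero (suc n) λ i → 𝟙-no (t i Fin.≟ s zero) λ tᵢ≡s₀ →
                t₀≰s₀ (subst (t zero Fin.≤_) tᵢ≡s₀ (weaklyIncreasing-head≤ t↑ i))

weaklyIncreasing-unique : ∀ {n k} (s t : Fin n → Fin k) → WeaklyIncreasing s → WeaklyIncreasing t →
                          (∀ v → count s v ≡ count t v) → s ≗ t
weaklyIncreasing-unique {zero} s t s↑ t↑ same ()
weaklyIncreasing-unique {suc n} s t s↑ t↑ same = λ where
    zero → s₀≡t₀
    (suc i) → weaklyIncreasing-unique (s ∘ suc) (t ∘ suc) (weaklyIncreasing-tail s↑) (weaklyIncreasing-tail t↑) same-tail i
  where
  s₀≡t₀ : s zero ≡ t zero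
  s₀≡t₀ = Finₚ.toℕ-injective (≤-antisym (weaklyIncreasing-head-≤ t s s↑ (sym ∘ same))
                                         (weaklyIncreasing-head-≤ s t t↑ same))
  same-tail : ∀ v → count (s ∘ suc) v ≡ count (t ∘ suc) v
  same-tail v = +-cancelˡ-≡ (𝟙 (t zero Fin.≟ v)) _ _
    (trans (cong (_+ count (s ∘ suc) v) (𝟙-⇔ (mk⇔ (trans s₀≡t₀) (trans (sym s₀≡t₀))) (t zero Fin.≟ v) (s zero Fin.≟ v))) (same v))

module _ (X : Digraph) where
  open Digraph X renaming (size to n)

  StrictOnDescents : (Fin n → Fin n) → ∀ {k} → (Fin n → Fin k) → Set
  StrictOnDescents π s = ∀ i j → toℕ j ≡ suc (toℕ i) → Edge (π i) (π j) → s i Fin.< s j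

  strictOnDescents? : ∀ π {k} (s : Fin n → Fin k) → Dec (StrictOnDescents π s)
  strictOnDescents? π s = Finₚ.all? λ i → Finₚ.all? λ j →
    toℕ j ℕ.≟ suc (toℕ i) →-dec edge? (π i) (π j) →-dec s i Finₚ.<? s j

  module _ {k} (π : Fin n → Fin n) (s₀ : Fin n → Fin k) (s₀↑ : WeaklyIncreasing s₀) where

    -- s₀ is the only weakly increasing index sequence with its content.
    goodSeq⇔ : ∀ s → GoodSeq X π (content s₀) s ⇔ (s₀ ≗ s × StrictOnDescents π s₀)
    goodSeq⇔ s = mk⇔
      (λ (s↑ , strict , same) → let s₀≗s = weaklyIncreasing-unique s₀ s s₀↑ s↑ (λ v →
                                              trans (sym (content≡count s₀ v)) (trans (sym (same v)) (content≡count s v)))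
                                in s₀≗s , λ i j j≡1+i e → subst₂ Fin._<_ (sym (s₀≗s i)) (sym (s₀≗s j)) (strict i j j≡1+i e))
      (λ (s₀≗s , strict) → (λ i j j≡1+i → subst₂ Fin._≤_ (s₀≗s i) (s₀≗s j) (s₀↑ i j j≡1+i)) ,
                           (λ i j j≡1+i e → subst₂ Fin._<_ (s₀≗s i) (s₀≗s j) (strict i j j≡1+i e)) ,
                           (λ v → trans (content≡count s v) (trans (count-cong (sym ∘ s₀≗s) v) (sym (content≡count s₀ v)))))

    coeffF-content : coeffF X π (content s₀) ≡ 𝟙 (strictOnDescents? π s₀)
    coeffF-content = begin
      length (filter (goodSeq? X π (content s₀)) (allFuns n k))
        ≡⟨ length-filter (goodSeq? X π (content s₀)) (allFuns n k) ⟩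
      sumˡ (map (𝟙 ∘ goodSeq? X π (content s₀)) (allFuns n k))
        ≡⟨ sumˡ-allFuns n k _ ⟩
      ∑ᶠ n k (𝟙 ∘ goodSeq? X π (content s₀))
        ≡⟨ ∑ᶠ-cong n (λ s → trans (𝟙-⇔ (goodSeq⇔ s) _ (s₀ ≗? s ×-dec strictOnDescents? π s₀))
                                  (𝟙-× (s₀ ≗? s) (strictOnDescents? π s₀))) ⟩
      ∑ᶠ n k (λ s → 𝟙 (s₀ ≗? s) * 𝟙 (strictOnDescents? π s₀))
        ≡⟨ ∑ᶠ-δ n k s₀ (λ _ → 𝟙 (strictOnDescents? π s₀)) (λ _ → refl) ⟩
      𝟙 (strictOnDescents? π s₀) ∎
      where open ≡-Reasoning

  coeffU-content : ∀ {k} (s₀ : Fin n → Fin k) → WeaklyIncreasing s₀ →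
                   coeffU X (content s₀) ≡ listingSum n (λ π → 𝟙 (strictOnDescents? π s₀))
  coeffU-content s₀ s₀↑ = trans (sumˡ-listings n _) (listingSum-cong λ π _ → coeffF-content π s₀ s₀↑)

∑-count : ∀ {n k} (s : Fin n → Fin k) → ∑[ v < k ] count s v ≡ n
∑-count {n} {k} s = begin
  ∑[ v < k ] ∑[ i < n ] 𝟙 (s i Fin.≟ v)        ≡⟨ ∑-comm (λ v i → 𝟙 (s i Fin.≟ v)) ⟩
  ∑[ i < n ] ∑[ v < k ] 𝟙 (s i Fin.≟ v)        ≡⟨ sum-cong-≗ (λ i → ∑-𝟙≟ (s i)) ⟩
  ∑[ i < n ] 1                                 ≡⟨ trans (∑-const n 1) (*-identityʳ n) ⟩
  n                                            ∎
  where open ≡-Reasoning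

-- x₁ x₂ ⋯ xₙ has a nonzero coefficient in U_X, all of whose monomials have degree |X|.
≡U⇒size≡ : (X Y : Digraph) → X ≡U Y → Digraph.size X ≡ Digraph.size Y
≡U⇒size≡ X Y X≡UY with Digraph.size X ℕ.≟ Digraph.size Y
... | yes n≡n′ = n≡n′
... | no n≢n′ = contradiction (≤-trans coeffX-positive (≤-reflexive (trans (X≡UY n (content idₙ)) coeffY≡0))) λ ()
  where
  n n′ : ℕ
  n = Digraph.size X
  n′ = Digraph.size Y
  idₙ : Fin n → Fin n
  idₙ = id
  id-strict : ∀ π → StrictOnDescents X π idₙ
  id-strict π i j j≡1+i _ = <-adjacent j≡1+i
  coeffX-positive : 1 ≤ coeffU X (content idₙ)
  coeffX-positive = begin
    1                                                   ≤⟨ term≤listingSum {n} (λ _ → 1) (λ _ → refl) ⟩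
    listingSum n (λ _ → 1)                              ≡⟨ listingSum-cong (λ π _ → 𝟙-yes (strictOnDescents? X π idₙ) (id-strict π)) ⟨
    listingSum n (λ π → 𝟙 (strictOnDescents? X π idₙ))  ≡⟨ coeffU-content X idₙ (λ i j → <⇒≤ ∘ <-adjacent) ⟨
    coeffU X (content idₙ)                              ∎
    where open ≤-Reasoning
  no-goodSeq : ∀ π s → ¬ GoodSeq Y π (content idₙ) s
  no-goodSeq π s (_ , _ , same) = n≢n′ (begin
    n                        ≡⟨ ∑-count idₙ ⟨
    ∑[ v < n ] count idₙ v   ≡⟨ sum-cong-≗ (λ v → trans (sym (content≡count idₙ v)) (trans (sym (same v)) (content≡count s v))) ⟩
    ∑[ v < n ] count s v     ≡⟨ ∑-count s ⟩
    n′                       ∎)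
    where open ≡-Reasoning
  coeffY≡0 : coeffU Y (content idₙ) ≡ 0
  coeffY≡0 = trans (sumˡ-listings n′ _) (listingSum-zero _ λ π _ →
    trans (length-filter (goodSeq? Y π (content idₙ)) (allFuns n′ n))
          (trans (sumˡ-allFuns n′ n (𝟙 ∘ goodSeq? Y π (content idₙ)))
                 (∑ᶠ-zero n′ λ s → 𝟙-no (goodSeq? Y π (content idₙ) s) (no-goodSeq π s))))

-- U_P determines the numbers of related pairs and of 3-chains

injective-cons : ∀ {r n} {a : Fin n} {t : Fin r → Fin n} → (∀ i → t i ≢ a) → IsInjective t → IsInjective (cons a t)
injective-cons t≢a t-inj zero zero _ = refl
injective-cons t≢a t-inj zero (suc j) a≡tⱼ = contradiction (sym a≡tⱼ) (t≢a j)
injective-cons t≢a t-inj (suc i) zero tᵢ≡a = contradiction tᵢ≡a (t≢a i)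
injective-cons t≢a t-inj (suc i) (suc j) tᵢ≡tⱼ = cong suc (t-inj i j tᵢ≡tⱼ)

∑ᶠ-injective-zero : ∀ {r n} → n < r → (R : (Fin r → Fin n) → ℕ) → ∑ᶠ r n (λ t → 𝟙 (injective? t) * R t) ≡ 0
∑ᶠ-injective-zero {r} n<r R = ∑ᶠ-zero r λ t → cong (_* R t) (𝟙-no (injective? t) λ t-inj →
                                Finₚ.<⇒notInjective n<r λ {i} {j} → t-inj i j)

module _ (P : FinPoset) where
  open FinPoset P renaming (size to n; _<_ to _≺_; _<?_ to _≺?_)
  open IsDecStrictPartialOrder isDSPO using (irrefl) renaming (trans to ≺-trans)

  lt : Fin n → Fin n → ℕ
  lt x y = 𝟙 (x ≺? y)

  up down : Fin n → ℕ
  up x = ∑[ y < n ] lt x y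
  down y = ∑[ x < n ] lt x y

  relationCount : ℕ
  relationCount = ∑[ x < n ] up x

  -- chains x < y < z, counted by their middle element
  chainCount : ℕ
  chainCount = ∑[ y < n ] (down y * up y)

  relationCount-tuples : ∑ᶠ 2 n (λ t → 𝟙 (injective? t) * lt (t 0F) (t 1F)) ≡ relationCount
  relationCount-tuples = begin
    ∑[ b < n ] ∑[ a < n ] (𝟙 (injective? (pair a b)) * lt a b)
      ≡⟨ sum-cong-≗ (λ b → sum-cong-≗ λ a → drop a b) ⟩
    ∑[ b < n ] ∑[ a < n ] lt a b
      ≡⟨ ∑-comm (λ b a → lt a b) ⟩
    relationCount ∎
    where
    open ≡-Reasoning
    pair : Fin n → Fin n → Fin 2 → Fin n
    pair a b = cons a (cons b λ ())
    drop : ∀ a b → 𝟙 (injective? (pair a b)) * lt a b ≡ lt a b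
    drop a b with a ≺? b
    ... | no _ = *-zeroʳ (𝟙 (injective? (pair a b)))
    ... | yes a<b = cong (_* 1) (𝟙-yes (injective? (pair a b))
                      (injective-cons (λ { 0F b≡a → irrefl (sym b≡a) a<b ; (suc ()) }) (injective-cons (λ ()) λ ())))

  chainCount-tuples : ∑ᶠ 3 n (λ t → 𝟙 (injective? t) * (lt (t 0F) (t 1F) * lt (t 1F) (t 2F))) ≡ chainCount
  chainCount-tuples = begin
    ∑[ c < n ] ∑[ b < n ] ∑[ a < n ] (𝟙 (injective? (triple a b c)) * (lt a b * lt b c))
      ≡⟨ sum-cong-≗ (λ c → sum-cong-≗ λ b → sum-cong-≗ λ a → drop a b c) ⟩
    ∑[ c < n ] ∑[ b < n ] ∑[ a < n ] (lt a b * lt b c)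
      ≡⟨ ∑-comm (λ c b → ∑[ a < n ] (lt a b * lt b c)) ⟩
    ∑[ b < n ] ∑[ c < n ] ∑[ a < n ] (lt a b * lt b c)
      ≡⟨ sum-cong-≗ (λ b → sum-cong-≗ λ c → sym (*-distribʳ-sum (lt b c) (λ a → lt a b))) ⟩
    ∑[ b < n ] ∑[ c < n ] (down b * lt b c)
      ≡⟨ sum-cong-≗ (λ b → sym (*-distribˡ-sum (down b) (lt b))) ⟩
    chainCount ∎
    where
    open ≡-Reasoning
    triple : Fin n → Fin n → Fin n → Fin 3 → Fin n
    triple a b c = cons a (cons b (cons c λ ()))
    drop : ∀ a b c → 𝟙 (injective? (triple a b c)) * (lt a b * lt b c) ≡ lt a b * lt b c
    drop a b c with a ≺? b | b ≺? c
    ... | no _ | _ = *-zeroʳ (𝟙 (injective? (triple a b c)))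
    ... | yes _ | no _ = *-zeroʳ (𝟙 (injective? (triple a b c)))
    ... | yes a≺b | yes b≺c = cong (_* 1) (𝟙-yes (injective? (triple a b c))
      (injective-cons (λ { 0F b≡a → irrefl (sym b≡a) a≺b ; 1F c≡a → irrefl (sym c≡a) (≺-trans a≺b b≺c) ; (suc (suc ())) })
        (injective-cons (λ { 0F c≡b → irrefl (sym c≡b) b≺c ; (suc ()) }) (injective-cons (λ ()) λ ()))))

digraphOf : ∀ {n} {E : Rel (Fin n) 0ℓ} → Decidable E → Digraph
digraphOf {n} {E} E? = record { size = n ; Edge = E ; edge? = E? }

-- content flat₂ is the monomial x₁² x₃ x₄ ⋯ xₙ, and content flat₃ is x₁³ x₄ x₅ ⋯ xₙ.
flat₂ : ∀ {n} → Fin n → Fin n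
flat₂ 0F = 0F
flat₂ 1F = 0F
flat₂ (suc (suc i)) = suc (suc i)

flat₃ : ∀ {n} → Fin n → Fin n
flat₃ 0F = 0F
flat₃ 1F = 0F
flat₃ 2F = 0F
flat₃ (suc (suc (suc i))) = suc (suc (suc i))

module _ {n : ℕ} where

  flat₂≤ : (i : Fin n) → flat₂ i Fin.≤ i
  flat₂≤ 0F = z≤n
  flat₂≤ 1F = z≤n
  flat₂≤ (suc (suc i)) = ≤-refl

  flat₃≤ : (i : Fin n) → flat₃ i Fin.≤ i
  flat₃≤ 0F = z≤n
  flat₃≤ 1F = z≤n
  flat₃≤ 2F = z≤n
  flat₃≤ (suc (suc (suc i))) = ≤-refl

  flat₂-weaklyIncreasing : WeaklyIncreasing (flat₂ {n})
  flat₂-weaklyIncreasing _ 0F ()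
  flat₂-weaklyIncreasing 0F 1F _ = z≤n
  flat₂-weaklyIncreasing (suc _) 1F ()
  flat₂-weaklyIncreasing i (suc (suc j)) j≡1+i = ≤-trans (flat₂≤ i) (<⇒≤ (<-adjacent j≡1+i))

  flat₃-weaklyIncreasing : WeaklyIncreasing (flat₃ {n})
  flat₃-weaklyIncreasing _ 0F ()
  flat₃-weaklyIncreasing 0F 1F _ = z≤n
  flat₃-weaklyIncreasing (suc _) 1F ()
  flat₃-weaklyIncreasing 0F 2F ()
  flat₃-weaklyIncreasing 1F 2F _ = z≤n
  flat₃-weaklyIncreasing (suc (suc _)) 2F ()
  flat₃-weaklyIncreasing i (suc (suc (suc j))) j≡1+i = ≤-trans (flat₃≤ i) (<⇒≤ (<-adjacent j≡1+i))

module _ {m : ℕ} {E : Rel (Fin (2 + m)) 0ℓ} (E? : Decidable E) where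

  strictOnDescents-flat₂⇔ : ∀ π → StrictOnDescents (digraphOf E?) π flat₂ ⇔ (¬ E (π 0F) (π 1F))
  strictOnDescents-flat₂⇔ π = mk⇔ (λ strict e → contradiction (strict 0F 1F refl e) λ ()) from
    where
    from : ¬ E (π 0F) (π 1F) → StrictOnDescents (digraphOf E?) π flat₂
    from _ _ 0F ()
    from ¬e 0F 1F _ e = contradiction e ¬e
    from _ (suc _) 1F ()
    from _ i (suc (suc j)) j≡1+i _ = ≤-<-trans (flat₂≤ i) (<-adjacent j≡1+i)

  coeffU-flat₂ : coeffU (digraphOf E?) (content flat₂) ≡ listingSum (2 + m) (λ π → 𝟙 (¬? (E? (π 0F) (π 1F))))
  coeffU-flat₂ = trans (coeffU-content (digraphOf E?) flat₂ flat₂-weaklyIncreasing) (listingSum-cong λ π _ →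
    𝟙-⇔ (strictOnDescents-flat₂⇔ π) (strictOnDescents? (digraphOf E?) π flat₂) (¬? (E? (π 0F) (π 1F))))

module _ {m : ℕ} {E : Rel (Fin (3 + m)) 0ℓ} (E? : Decidable E) where

  strictOnDescents-flat₃⇔ : ∀ π → StrictOnDescents (digraphOf E?) π flat₃ ⇔ (¬ E (π 0F) (π 1F) × ¬ E (π 1F) (π 2F))
  strictOnDescents-flat₃⇔ π = mk⇔ (λ strict → (λ e → contradiction (strict 0F 1F refl e) λ ()) ,
                                               (λ e → contradiction (strict 1F 2F refl e) λ ())) from
    where
    from : ¬ E (π 0F) (π 1F) × ¬ E (π 1F) (π 2F) → StrictOnDescents (digraphOf E?) π flat₃
    from _ _ 0F ()
    from (¬e₀₁ , _) 0F 1F _ e = contradiction e ¬e₀₁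
    from _ (suc _) 1F ()
    from _ 0F 2F ()
    from (_ , ¬e₁₂) 1F 2F _ e = contradiction e ¬e₁₂
    from _ (suc (suc _)) 2F ()
    from _ i (suc (suc (suc j))) j≡1+i _ = ≤-<-trans (flat₃≤ i) (<-adjacent j≡1+i)

  coeffU-flat₃ : coeffU (digraphOf E?) (content flat₃) ≡
                 listingSum (3 + m) (λ π → 𝟙 (¬? (E? (π 0F) (π 1F))) * 𝟙 (¬? (E? (π 1F) (π 2F))))
  coeffU-flat₃ = trans (coeffU-content (digraphOf E?) flat₃ flat₃-weaklyIncreasing)
    (listingSum-cong {g = λ π → 𝟙 (strict? π)} {h = λ π → 𝟙 (¬e₀₁? π) * 𝟙 (¬e₁₂? π)} λ π _ →
      trans (𝟙-⇔ (strictOnDescents-flat₃⇔ π) (strict? π) (¬e₀₁? π ×-dec ¬e₁₂? π)) (𝟙-× (¬e₀₁? π) (¬e₁₂? π)))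
    where
    strict? : ∀ π → Dec (StrictOnDescents (digraphOf E?) π flat₃)
    strict? π = strictOnDescents? (digraphOf E?) π flat₃
    ¬e₀₁? : ∀ π → Dec (¬ E (π 0F) (π 1F))
    ¬e₀₁? π = ¬? (E? (π 0F) (π 1F))
    ¬e₁₂? : ∀ π → Dec (¬ E (π 1F) (π 2F))
    ¬e₁₂? π = ¬? (E? (π 1F) (π 2F))

module _ {n : ℕ} {p q} {A : (Fin n → Fin n) → Set p} {B : (Fin n → Fin n) → Set q}
         (a? : ∀ π → Dec (A π)) (b? : ∀ π → Dec (B π)) where

  listingSum-¬-cancel : listingSum n (λ π → 𝟙 (¬? (a? π))) ≡ listingSum n (λ π → 𝟙 (¬? (b? π))) →
                        listingSum n (λ π → 𝟙 (a? π)) ≡ listingSum n (λ π → 𝟙 (b? π))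
  listingSum-¬-cancel ¬a≡¬b = +-cancelʳ-≡ _ _ _ (begin
    listingSum n (λ π → 𝟙 (a? π)) + listingSum n (λ π → 𝟙 (¬? (a? π)))
      ≡⟨ listingSum-+ (λ π → 𝟙 (a? π)) (λ π → 𝟙 (¬? (a? π))) ⟨
    listingSum n (λ π → 𝟙 (a? π) + 𝟙 (¬? (a? π)))
      ≡⟨ listingSum-cong {g = λ π → 𝟙 (a? π) + 𝟙 (¬? (a? π))} {h = λ π → 𝟙 (b? π) + 𝟙 (¬? (b? π))}
                         (λ π _ → trans (𝟙-¬ (a? π)) (sym (𝟙-¬ (b? π)))) ⟩
    listingSum n (λ π → 𝟙 (b? π) + 𝟙 (¬? (b? π)))
      ≡⟨ listingSum-+ (λ π → 𝟙 (b? π)) (λ π → 𝟙 (¬? (b? π))) ⟩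
    listingSum n (λ π → 𝟙 (b? π)) + listingSum n (λ π → 𝟙 (¬? (b? π)))
      ≡⟨ cong (listingSum n (λ π → 𝟙 (b? π)) +_) ¬a≡¬b ⟨
    listingSum n (λ π → 𝟙 (b? π)) + listingSum n (λ π → 𝟙 (¬? (a? π))) ∎)
    where open ≡-Reasoning

  listingSum-inclusion-exclusion :
    listingSum n (λ π → 𝟙 (¬? (a? π)) * 𝟙 (¬? (b? π))) + (listingSum n (λ π → 𝟙 (a? π)) + listingSum n (λ π → 𝟙 (b? π)))
    ≡ listingSum n (λ _ → 1) + listingSum n (λ π → 𝟙 (a? π) * 𝟙 (b? π))
  listingSum-inclusion-exclusion = begin
    listingSum n ¬a¬b + (listingSum n a + listingSum n b)  ≡⟨ cong (listingSum n ¬a¬b +_) (listingSum-+ a b) ⟨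
    listingSum n ¬a¬b + listingSum n (λ π → a π + b π)    ≡⟨ listingSum-+ ¬a¬b (λ π → a π + b π) ⟨
    listingSum n (λ π → ¬a¬b π + (a π + b π))            ≡⟨ listingSum-cong {g = λ π → ¬a¬b π + (a π + b π)} {h = λ π → 1 + a π * b π}
                                                              (λ π _ → 𝟙-inclusion-exclusion (a? π) (b? π)) ⟩
    listingSum n (λ π → 1 + a π * b π)                   ≡⟨ listingSum-+ (λ _ → 1) (λ π → a π * b π) ⟩
    listingSum n (λ _ → 1) + listingSum n (λ π → a π * b π) ∎
    where
    open ≡-Reasoning
    a b ¬a¬b : (Fin n → Fin n) → ℕ
    a π = 𝟙 (a? π)
    b π = 𝟙 (b? π)
    ¬a¬b π = 𝟙 (¬? (a? π)) * 𝟙 (¬? (b? π))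

finPoset : ∀ {n} {_≺_ : Rel (Fin n) 0ℓ} → IsDecStrictPartialOrder _≡_ _≺_ → FinPoset
finPoset {n} {_≺_} o = record { size = n ; _<_ = _≺_ ; isDSPO = o }

module _ (P : FinPoset) where
  open FinPoset P renaming (size to n)

  relatedPair : (Fin 2 → Fin n) → ℕ
  relatedPair t = lt P (t 0F) (t 1F)

  chain₃ : (Fin 3 → Fin n) → ℕ
  chain₃ t = lt P (t 0F) (t 1F) * lt P (t 1F) (t 2F)

  extensional-relatedPair : Extensional relatedPair
  extensional-relatedPair t≗t′ = cong₂ (lt P) (t≗t′ 0F) (t≗t′ 1F)

  extensional-chain₃ : Extensional chain₃
  extensional-chain₃ t≗t′ = cong₂ _*_ (cong₂ (lt P) (t≗t′ 0F) (t≗t′ 1F)) (cong₂ (lt P) (t≗t′ 1F) (t≗t′ 2F))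

↑ˡ-injective : ∀ {r} m → IsInjective {r} (Fin._↑ˡ m)
↑ˡ-injective m i j = Finₚ.↑ˡ-injective m i j

module _ {m : ℕ} {_≺₁_ _≺₂_ : Rel (Fin (2 + m)) 0ℓ}
         (o₁ : IsDecStrictPartialOrder _≡_ _≺₁_) (o₂ : IsDecStrictPartialOrder _≡_ _≺₂_) where
  private
    P Q : FinPoset
    P = finPoset o₁
    Q = finPoset o₂
    open IsDecStrictPartialOrder o₁ using () renaming (_<?_ to _≺₁?_)
    open IsDecStrictPartialOrder o₂ using () renaming (_<?_ to _≺₂?_)

  U-eq⇒relationCount≡ : U-eq P Q → relationCount P ≡ relationCount Q
  U-eq⇒relationCount≡ P≡Q = begin
    relationCount P                                         ≡⟨ relationCount-tuples P ⟨
    ∑ᶠ 2 (2 + m) (λ t → 𝟙 (injective? t) * relatedPair P t)  ≡⟨ listingSums≡⇒tupleSums≡ (relatedPair P) (relatedPair Q)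
                                                                  (extensional-relatedPair P) (extensional-relatedPair Q) related≡ ⟩
    ∑ᶠ 2 (2 + m) (λ t → 𝟙 (injective? t) * relatedPair Q t)  ≡⟨ relationCount-tuples Q ⟩
    relationCount Q                                         ∎
    where
    open ≡-Reasoning
    open Positions (Fin._↑ˡ m) (↑ˡ-injective m)
    unrelated≡ : listingSum (2 + m) (λ π → 𝟙 (¬? (π 0F ≺₁? π 1F))) ≡ listingSum (2 + m) (λ π → 𝟙 (¬? (π 0F ≺₂? π 1F)))
    unrelated≡ = trans (sym (coeffU-flat₂ _≺₁?_)) (trans (P≡Q (2 + m) (content flat₂)) (coeffU-flat₂ _≺₂?_))
    related≡ : listingSum (2 + m) (λ π → 𝟙 (π 0F ≺₁? π 1F)) ≡ listingSum (2 + m) (λ π → 𝟙 (π 0F ≺₂? π 1F))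
    related≡ = listingSum-¬-cancel (λ π → π 0F ≺₁? π 1F) (λ π → π 0F ≺₂? π 1F) unrelated≡

module _ {m : ℕ} {_≺₁_ _≺₂_ : Rel (Fin (3 + m)) 0ℓ}
         (o₁ : IsDecStrictPartialOrder _≡_ _≺₁_) (o₂ : IsDecStrictPartialOrder _≡_ _≺₂_) where
  private
    P Q : FinPoset
    P = finPoset o₁
    Q = finPoset o₂
    open IsDecStrictPartialOrder o₁ using () renaming (_<?_ to _≺₁?_)
    open IsDecStrictPartialOrder o₂ using () renaming (_<?_ to _≺₂?_)

  -- The pair counts enter through inclusion–exclusion on the two adjacent relations.
  U-eq⇒chainCount≡ : U-eq P Q → relationCount P ≡ relationCount Q → chainCount P ≡ chainCount Q
  U-eq⇒chainCount≡ P≡Q relations≡ = begin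
    chainCount P                                       ≡⟨ chainCount-tuples P ⟨
    ∑ᶠ 3 (3 + m) (λ t → 𝟙 (injective? t) * chain₃ P t)  ≡⟨ Positions.listingSums≡⇒tupleSums≡ (Fin._↑ˡ m) (↑ˡ-injective m)
                                                             (chain₃ P) (chain₃ Q) (extensional-chain₃ P) (extensional-chain₃ Q) chains≡ ⟩
    ∑ᶠ 3 (3 + m) (λ t → 𝟙 (injective? t) * chain₃ Q t)  ≡⟨ chainCount-tuples Q ⟩
    chainCount Q                                       ∎
    where
    open ≡-Reasoning
    related-at≡ : (z : Fin 2 → Fin (3 + m)) → IsInjective z →
                  listingSum (3 + m) (λ π → relatedPair P (π ∘ z)) ≡ listingSum (3 + m) (λ π → relatedPair Q (π ∘ z))
    related-at≡ z z-inj = begin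
      listingSum (3 + m) (λ π → relatedPair P (π ∘ z))
        ≡⟨ listingSum-∘positions (relatedPair P) (extensional-relatedPair P) ⟩
      fiberSize * ∑ᶠ 2 (3 + m) (λ t → 𝟙 (injective? t) * relatedPair P t)
        ≡⟨ cong (fiberSize *_) (trans (relationCount-tuples P) (trans relations≡ (sym (relationCount-tuples Q)))) ⟩
      fiberSize * ∑ᶠ 2 (3 + m) (λ t → 𝟙 (injective? t) * relatedPair Q t)
        ≡⟨ listingSum-∘positions (relatedPair Q) (extensional-relatedPair Q) ⟨
      listingSum (3 + m) (λ π → relatedPair Q (π ∘ z)) ∎
      where open Positions z z-inj
    unrelated≡ : listingSum (3 + m) (λ π → 𝟙 (¬? (π 0F ≺₁? π 1F)) * 𝟙 (¬? (π 1F ≺₁? π 2F))) ≡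
                 listingSum (3 + m) (λ π → 𝟙 (¬? (π 0F ≺₂? π 1F)) * 𝟙 (¬? (π 1F ≺₂? π 2F)))
    unrelated≡ = trans (sym (coeffU-flat₃ _≺₁?_)) (trans (P≡Q (3 + m) (content flat₃)) (coeffU-flat₃ _≺₂?_))
    chains≡ : listingSum (3 + m) (λ π → chain₃ P (π ∘ (Fin._↑ˡ m))) ≡ listingSum (3 + m) (λ π → chain₃ Q (π ∘ (Fin._↑ˡ m)))
    chains≡ = +-cancelˡ-≡ (listingSum (3 + m) (λ _ → 1)) _ _ (begin
      listingSum (3 + m) (λ _ → 1) + listingSum (3 + m) (λ π → chain₃ P (π ∘ (Fin._↑ˡ m)))
        ≡⟨ listingSum-inclusion-exclusion (λ π → π 0F ≺₁? π 1F) (λ π → π 1F ≺₁? π 2F) ⟨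
      _ ≡⟨ cong₂ _+_ unrelated≡ (cong₂ _+_ (related-at≡ (Fin._↑ˡ suc m) (↑ˡ-injective (suc m)))
                                           (related-at≡ (λ i → suc (i Fin.↑ˡ m)) λ i j eq → ↑ˡ-injective m i j (Finₚ.suc-injective eq))) ⟩
      _ ≡⟨ listingSum-inclusion-exclusion (λ π → π 0F ≺₂? π 1F) (λ π → π 1F ≺₂? π 2F) ⟩
      listingSum (3 + m) (λ _ → 1) + listingSum (3 + m) (λ π → chain₃ Q (π ∘ (Fin._↑ˡ m))) ∎)

relationCount-small : (P : FinPoset) → FinPoset.size P < 2 → relationCount P ≡ 0
relationCount-small P n<2 = trans (sym (relationCount-tuples P)) (∑ᶠ-injective-zero n<2 (relatedPair P))

chainCount-small : (P : FinPoset) → FinPoset.size P < 3 → chainCount P ≡ 0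
chainCount-small P n<3 = trans (sym (chainCount-tuples P)) (∑ᶠ-injective-zero n<3 (chain₃ P))

U-eq⇒counts≡ : (P Q : FinPoset) → U-eq P Q → relationCount P ≡ relationCount Q × chainCount P ≡ chainCount Q
U-eq⇒counts≡ P Q P≡Q = counts≡ P Q (≡U⇒size≡ (D P) (D Q) P≡Q) P≡Q
  where
  counts≡ : (P Q : FinPoset) → FinPoset.size P ≡ FinPoset.size Q → U-eq P Q →
            relationCount P ≡ relationCount Q × chainCount P ≡ chainCount Q
  counts≡ P@record { size = 0 } Q refl _ =
    trans (relationCount-small P ℕ.z<s) (sym (relationCount-small Q ℕ.z<s)) ,
    trans (chainCount-small P ℕ.z<s) (sym (chainCount-small Q ℕ.z<s))
  counts≡ P@record { size = 1 } Q refl _ =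
    trans (relationCount-small P (ℕ.s<s ℕ.z<s)) (sym (relationCount-small Q (ℕ.s<s ℕ.z<s))) ,
    trans (chainCount-small P (ℕ.s<s ℕ.z<s)) (sym (chainCount-small Q (ℕ.s<s ℕ.z<s)))
  counts≡ P@record { size = 2 ; isDSPO = o₁ } Q@record { isDSPO = o₂ } refl P≡Q =
    U-eq⇒relationCount≡ o₁ o₂ P≡Q ,
    trans (chainCount-small P (ℕ.s<s (ℕ.s<s ℕ.z<s))) (sym (chainCount-small Q (ℕ.s<s (ℕ.s<s ℕ.z<s))))
  counts≡ P@record { size = suc (suc (suc m)) ; isDSPO = o₁ } Q@record { isDSPO = o₂ } refl P≡Q =
    relations≡ , U-eq⇒chainCount≡ o₁ o₂ P≡Q relations≡
    where
    relations≡ : relationCount P ≡ relationCount Q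
    relations≡ = U-eq⇒relationCount≡ o₁ o₂ P≡Q

-- Power sums of the chain lengths

module UpSets {n : ℕ} {_⊏_ : Rel (Fin n) 0ℓ} (_⊏?_ : Decidable _⊏_)
               (⊏-irrefl : ∀ {x} → ¬ x ⊏ x) (⊏-trans : ∀ {x y z} → x ⊏ y → y ⊏ z → x ⊏ z)
               (above-comparable : ∀ {x y z} → x ⊏ y → x ⊏ z → y ≢ z → y ⊏ z ⊎ z ⊏ y) where

  [_⊏_] : Fin n → Fin n → ℕ
  [ x ⊏ y ] = 𝟙 (x ⊏? y)

  above : Fin n → ℕ
  above x = ∑[ y < n ] [ x ⊏ y ]

  ⊏-asym : ∀ {x y} → x ⊏ y → ¬ y ⊏ x
  ⊏-asym x⊏y y⊏x = ⊏-irrefl (⊏-trans x⊏y y⊏x)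

  -- Two elements above x are equal or comparable, and in exactly one way.
  above-pair : ∀ x y z → [ x ⊏ y ] * [ x ⊏ z ] ≡ 𝟙 (y Fin.≟ z) * [ x ⊏ y ] + ([ x ⊏ y ] * [ y ⊏ z ] + [ x ⊏ z ] * [ z ⊏ y ])
  above-pair x y z with x ⊏? y | x ⊏? z | y Fin.≟ z
  ... | no _ | no _ | yes _ = refl
  ... | no _ | no _ | no _ = refl
  ... | yes x⊏y | no x⋢z | yes refl = contradiction x⊏y x⋢z
  ... | yes x⊏y | no x⋢z | no _ with y ⊏? z
  ...   | yes y⊏z = contradiction (⊏-trans x⊏y y⊏z) x⋢z
  ...   | no _ = refl
  above-pair x y z | no x⋢y | yes x⊏z | yes refl = contradiction x⊏z x⋢y
  above-pair x y z | no x⋢y | yes x⊏z | no _ with z ⊏? y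
  ...   | yes z⊏y = contradiction (⊏-trans x⊏z z⊏y) x⋢y
  ...   | no _ = refl
  above-pair x y z | yes _ | yes _ | yes refl with y ⊏? y
  ...   | yes y⊏y = contradiction y⊏y ⊏-irrefl
  ...   | no _ = refl
  above-pair x y z | yes x⊏y | yes x⊏z | no y≢z with y ⊏? z | z ⊏? y
  ...   | yes y⊏z | yes z⊏y = contradiction z⊏y (⊏-asym y⊏z)
  ...   | yes _ | no _ = refl
  ...   | no _ | yes _ = refl
  ...   | no y⋢z | no z⋢y = ⊥-elim ([ y⋢z , z⋢y ]′ (above-comparable x⊏y x⊏z y≢z))

  above-squared : ∀ x → above x * above x ≡ above x + (∑[ y < n ] ([ x ⊏ y ] * above y) + ∑[ y < n ] ([ x ⊏ y ] * above y))
  above-squared x = begin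
    above x * above x
      ≡⟨ *-distribʳ-sum (above x) [ x ⊏_] ⟩
    ∑[ y < n ] ([ x ⊏ y ] * above x)
      ≡⟨ sum-cong-≗ (λ y → *-distribˡ-sum [ x ⊏ y ] [ x ⊏_]) ⟩
    ∑[ y < n ] ∑[ z < n ] ([ x ⊏ y ] * [ x ⊏ z ])
      ≡⟨ sum-cong-≗ (λ y → sum-cong-≗ λ z → above-pair x y z) ⟩
    ∑[ y < n ] ∑[ z < n ] (𝟙 (y Fin.≟ z) * [ x ⊏ y ] + ([ x ⊏ y ] * [ y ⊏ z ] + [ x ⊏ z ] * [ z ⊏ y ]))
      ≡⟨ sum-cong-≗ (λ y → trans (∑-distrib-+ (λ z → 𝟙 (y Fin.≟ z) * [ x ⊏ y ])
                                              (λ z → [ x ⊏ y ] * [ y ⊏ z ] + [ x ⊏ z ] * [ z ⊏ y ]))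
                                  (cong₂ _+_ (∑-δ y (λ _ → [ x ⊏ y ]))
                                             (∑-distrib-+ (λ z → [ x ⊏ y ] * [ y ⊏ z ]) (λ z → [ x ⊏ z ] * [ z ⊏ y ])))) ⟩
    ∑[ y < n ] ([ x ⊏ y ] + (∑[ z < n ] ([ x ⊏ y ] * [ y ⊏ z ]) + ∑[ z < n ] ([ x ⊏ z ] * [ z ⊏ y ])))
      ≡⟨ trans (∑-distrib-+ [ x ⊏_] (λ y → ∑[ z < n ] ([ x ⊏ y ] * [ y ⊏ z ]) + ∑[ z < n ] ([ x ⊏ z ] * [ z ⊏ y ])))
               (cong (above x +_) (∑-distrib-+ (λ y → ∑[ z < n ] ([ x ⊏ y ] * [ y ⊏ z ])) (λ y → ∑[ z < n ] ([ x ⊏ z ] * [ z ⊏ y ])))) ⟩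
    above x + (∑[ y < n ] ∑[ z < n ] ([ x ⊏ y ] * [ y ⊏ z ]) + ∑[ y < n ] ∑[ z < n ] ([ x ⊏ z ] * [ z ⊏ y ]))
      ≡⟨ cong (λ s → above x + (∑[ y < n ] ∑[ z < n ] ([ x ⊏ y ] * [ y ⊏ z ]) + s)) (∑-comm (λ y z → [ x ⊏ z ] * [ z ⊏ y ])) ⟩
    above x + (∑[ y < n ] ∑[ z < n ] ([ x ⊏ y ] * [ y ⊏ z ]) + ∑[ z < n ] ∑[ y < n ] ([ x ⊏ z ] * [ z ⊏ y ]))
      ≡⟨ cong (λ s → above x + (s + s)) (sum-cong-≗ λ y → sym (*-distribˡ-sum [ x ⊏ y ] [ y ⊏_])) ⟩
    above x + (∑[ y < n ] ([ x ⊏ y ] * above y) + ∑[ y < n ] ([ x ⊏ y ] * above y)) ∎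
    where open ≡-Reasoning

square-of-1+u+d : ∀ u d a b → u * u ≡ u + (a + a) → d * d ≡ d + (b + b) →
                  (1 + (u + d)) ^ 2 ≡ 1 + (3 * u + (3 * d + (2 * a + (2 * b + 2 * (d * u)))))
square-of-1+u+d u d a b u² d² = begin
  (1 + (u + d)) ^ 2                                                ≡⟨ expand u d ⟩
  1 + 2 * u + 2 * d + u * u + d * d + 2 * (d * u)                  ≡⟨ cong₂ (λ s t → 1 + 2 * u + 2 * d + s + t + 2 * (d * u)) u² d² ⟩
  1 + 2 * u + 2 * d + (u + (a + a)) + (d + (b + b)) + 2 * (d * u)  ≡⟨ collect u d a b ⟩
  1 + (3 * u + (3 * d + (2 * a + (2 * b + 2 * (d * u)))))          ∎
  where
  open ≡-Reasoning
  expand : ∀ u d → (1 + (u + d)) * ((1 + (u + d)) * 1) ≡ 1 + 2 * u + 2 * d + u * u + d * d + 2 * (d * u)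
  expand = solve-∀
  collect : ∀ u d a b → 1 + 2 * u + 2 * d + (u + (a + a)) + (d + (b + b)) + 2 * (d * u) ≡
                        1 + (3 * u + (3 * d + (2 * a + (2 * b + 2 * (d * u)))))
  collect = solve-∀

powerSum : ∀ {k} → (Fin k → ℕ) → ℕ → ℕ
powerSum {k} ℓ j = ∑[ c < k ] (ℓ c ^ j)

module ChainUnion (P : FinPoset) {k : ℕ} (chains : IsUnionOfChains P k) where
  open FinPoset P renaming (size to n; _<_ to _≺_; _<?_ to _≺?_)
  open IsDecStrictPartialOrder isDSPO using (irrefl; asym) renaming (trans to ≺-trans)

  block : Fin n → Fin k
  block = proj₁ chains

  comparable : ∀ x y → x ≢ y → block x ≡ block y → x ≺ y ⊎ y ≺ x
  comparable = proj₁ (proj₂ (proj₂ chains))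

  incomparable : ∀ x y → block x ≢ block y → ¬ x ≺ y
  incomparable = proj₂ (proj₂ (proj₂ chains))

  block-≺ : ∀ {x y} → x ≺ y → block x ≡ block y
  block-≺ {x} {y} x≺y with block x Fin.≟ block y
  ... | yes same = same
  ... | no differ = contradiction x≺y (incomparable x y differ)

  blockSize : Fin k → ℕ
  blockSize c = ∑[ x < n ] 𝟙 (block x Fin.≟ c)

  sameBlock : ∀ x y → 𝟙 (block y Fin.≟ block x) ≡ 𝟙 (x Fin.≟ y) + (lt P x y + lt P y x)
  sameBlock x y with x Fin.≟ y
  ... | yes refl = trans (𝟙-yes (block x Fin.≟ block x) refl)
                         (cong suc (sym (cong₂ _+_ (𝟙-no (x ≺? x) (irrefl refl)) (𝟙-no (x ≺? x) (irrefl refl)))))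
  ... | no x≢y with block y Fin.≟ block x
  ...   | no differ = sym (cong₂ _+_ (𝟙-no (x ≺? y) (incomparable x y (differ ∘ sym))) (𝟙-no (y ≺? x) (incomparable y x differ)))
  ...   | yes same with comparable x y x≢y (sym same)
  ...     | inj₁ x≺y = sym (cong₂ _+_ (𝟙-yes (x ≺? y) x≺y) (𝟙-no (y ≺? x) (asym x≺y)))
  ...     | inj₂ y≺x = sym (cong₂ _+_ (𝟙-no (x ≺? y) (asym y≺x)) (𝟙-yes (y ≺? x) y≺x))

  blockSize-block : ∀ x → blockSize (block x) ≡ 1 + (up P x + down P x)
  blockSize-block x = begin
    ∑[ y < n ] 𝟙 (block y Fin.≟ block x)                  ≡⟨ sum-cong-≗ (sameBlock x) ⟩
    ∑[ y < n ] (𝟙 (x Fin.≟ y) + (lt P x y + lt P y x))    ≡⟨ ∑-distrib-+ (λ y → 𝟙 (x Fin.≟ y)) (λ y → lt P x y + lt P y x) ⟩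
    ∑[ y < n ] 𝟙 (x Fin.≟ y) + ∑[ y < n ] (lt P x y + lt P y x)
      ≡⟨ cong₂ _+_ (∑-𝟙≟ x) (∑-distrib-+ (lt P x) (λ y → lt P y x)) ⟩
    1 + (up P x + down P x)                                ∎
    where open ≡-Reasoning

  ∑-blocks : (g : ℕ → ℕ) → ∑[ c < k ] (blockSize c * g (blockSize c)) ≡ ∑[ x < n ] g (blockSize (block x))
  ∑-blocks g = begin
    ∑[ c < k ] (blockSize c * g (blockSize c))
      ≡⟨ sum-cong-≗ (λ c → *-distribʳ-sum (g (blockSize c)) (λ x → 𝟙 (block x Fin.≟ c))) ⟩
    ∑[ c < k ] ∑[ x < n ] (𝟙 (block x Fin.≟ c) * g (blockSize c))
      ≡⟨ ∑-comm (λ c x → 𝟙 (block x Fin.≟ c) * g (blockSize c)) ⟩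
    ∑[ x < n ] ∑[ c < k ] (𝟙 (block x Fin.≟ c) * g (blockSize c))
      ≡⟨ sum-cong-≗ (λ x → ∑-δ (block x) (g ∘ blockSize)) ⟩
    ∑[ x < n ] g (blockSize (block x)) ∎
    where open ≡-Reasoning

  powerSum-blockSize-suc : ∀ j → powerSum blockSize (suc j) ≡ ∑[ x < n ] ((1 + (up P x + down P x)) ^ j)
  powerSum-blockSize-suc j = trans (∑-blocks (_^ j)) (sum-cong-≗ λ x → cong (_^ j) (blockSize-block x))

  powerSum₁-blockSize : powerSum blockSize 1 ≡ n
  powerSum₁-blockSize = trans (powerSum-blockSize-suc 0) (trans (∑-const n 1) (*-identityʳ n))

  powerSum₂-blockSize : powerSum blockSize 2 ≡ n + (relationCount P + relationCount P)
  powerSum₂-blockSize = begin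
    powerSum blockSize 2                                ≡⟨ powerSum-blockSize-suc 1 ⟩
    ∑[ x < n ] ((1 + (up P x + down P x)) * 1)          ≡⟨ sum-cong-≗ (λ x → *-identityʳ (1 + (up P x + down P x))) ⟩
    ∑[ x < n ] (1 + (up P x + down P x))                ≡⟨ ∑-distrib-+ (λ _ → 1) (λ x → up P x + down P x) ⟩
    ∑[ x < n ] 1 + ∑[ x < n ] (up P x + down P x)       ≡⟨ cong₂ _+_ (trans (∑-const n 1) (*-identityʳ n)) (∑-distrib-+ (up P) (down P)) ⟩
    n + (relationCount P + ∑[ x < n ] down P x)         ≡⟨ cong (λ s → n + (relationCount P + s)) (∑-comm (λ x y → lt P y x)) ⟩
    n + (relationCount P + relationCount P)             ∎
    where open ≡-Reasoning

  private
    above-comparable : ∀ {x y z} → x ≺ y → x ≺ z → y ≢ z → y ≺ z ⊎ z ≺ y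
    above-comparable x≺y x≺z y≢z = comparable _ _ y≢z (trans (sym (block-≺ x≺y)) (block-≺ x≺z))
    below-comparable : ∀ {x y z} → y ≺ x → z ≺ x → y ≢ z → z ≺ y ⊎ y ≺ z
    below-comparable y≺x z≺x y≢z = [ inj₂ , inj₁ ]′ (comparable _ _ y≢z (trans (block-≺ y≺x) (sym (block-≺ z≺x))))

  module Up = UpSets _≺?_ (irrefl refl) ≺-trans above-comparable
  module Down = UpSets (flip _≺?_) (irrefl refl) (flip ≺-trans) below-comparable

  powerSum₃-blockSize : powerSum blockSize 3 ≡ n + 6 * relationCount P + 6 * chainCount P
  powerSum₃-blockSize = begin
    powerSum blockSize 3
      ≡⟨ powerSum-blockSize-suc 2 ⟩
    ∑[ x < n ] ((1 + (up P x + down P x)) ^ 2)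
      ≡⟨ sum-cong-≗ (λ x → square-of-1+u+d (up P x) (down P x) (chainsFrom x) (chainsTo x) (Up.above-squared x) (Down.above-squared x)) ⟩
    ∑[ x < n ] (1 + (3 * up P x + (3 * down P x + (2 * chainsFrom x + (2 * chainsTo x + 2 * (down P x * up P x))))))
      ≡⟨ ∑-+-≡ (λ _ → 1) r₁ (trans (∑-const n 1) (*-identityʳ n))
         (∑-+-≡ (λ x → 3 * up P x) r₂ (∑-*-≡ 3 (up P) refl)
         (∑-+-≡ (λ x → 3 * down P x) r₃ (∑-*-≡ 3 (down P) ∑-down)
         (∑-+-≡ (λ x → 2 * chainsFrom x) r₄ (∑-*-≡ 2 chainsFrom ∑-chainsFrom)
         (∑-+-≡ (λ x → 2 * chainsTo x) r₅ (∑-*-≡ 2 chainsTo ∑-chainsTo)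
         (∑-*-≡ 2 (λ x → down P x * up P x) refl))))) ⟩
    n + (3 * A + (3 * A + (2 * C + (2 * C + 2 * C))))
      ≡⟨ collect n A C ⟩
    n + 6 * A + 6 * C ∎
    where
    open ≡-Reasoning
    A C : ℕ
    A = relationCount P
    C = chainCount P
    chainsFrom chainsTo : Fin n → ℕ
    chainsFrom x = ∑[ y < n ] (lt P x y * up P y)
    chainsTo x = ∑[ y < n ] (lt P y x * down P y)
    ∑-down : ∑[ x < n ] down P x ≡ A
    ∑-down = ∑-comm (λ x y → lt P y x)
    ∑-chainsFrom : ∑[ x < n ] chainsFrom x ≡ C
    ∑-chainsFrom = trans (∑-comm (λ x y → lt P x y * up P y)) (sum-cong-≗ λ y → sym (*-distribʳ-sum (up P y) (λ x → lt P x y)))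
    ∑-chainsTo : ∑[ x < n ] chainsTo x ≡ C
    ∑-chainsTo = trans (∑-comm (λ x y → lt P y x * down P y))
                       (sum-cong-≗ λ y → trans (sym (*-distribʳ-sum (down P y) (lt P y))) (*-comm (up P y) (down P y)))
    collect : ∀ n A C → n + (3 * A + (3 * A + (2 * C + (2 * C + 2 * C)))) ≡ n + 6 * A + 6 * C
    collect = solve-∀
    r₁ r₂ r₃ r₄ r₅ : Fin n → ℕ
    r₅ x = 2 * (down P x * up P x)
    r₄ x = 2 * chainsTo x + r₅ x
    r₃ x = 2 * chainsFrom x + r₄ x
    r₂ x = 3 * down P x + r₃ x
    r₁ x = 3 * up P x + r₂ x

-- At most three numbers are determined by their first three power sums

multiplicity : ∀ {k} → (Fin k → ℕ) → ℕ → ℕ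
multiplicity {k} ℓ v = ∑[ c < k ] 𝟙 (ℓ c ℕ.≟ v)

powerSumˡ : ℕ → List ℕ → ℕ
powerSumˡ j xs = sumˡ (map (_^ j) xs)

powerSumˡ-↭ : ∀ j {xs ys} → xs ↭ ys → powerSumˡ j xs ≡ powerSumˡ j ys
powerSumˡ-↭ j xs↭ys = sum-↭ (map⁺ (_^ j) xs↭ys)

pos-^ : ∀ x j → ℤ.+ (x ^ j) ≡ (ℤ.+ x) ℤ.^ j
pos-^ x zero = refl
pos-^ x (suc j) = trans (ℤₚ.pos-* x (x ^ j)) (cong (ℤ.+ x ℤ.*_) (pos-^ x j))

pos-powerSumˡ₂ : ∀ j b c → ℤ.+ powerSumˡ j (b ∷ c ∷ []) ≡ IntegerRoots.powerSum₂ j (ℤ.+ b) (ℤ.+ c)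
pos-powerSumˡ₂ j b c = trans (ℤₚ.pos-+ (b ^ j) _) (cong₂ ℤ._+_ (pos-^ b j) (trans (ℤₚ.pos-+ (c ^ j) 0) (cong (ℤ._+ ℤ.0ℤ) (pos-^ c j))))

pos-powerSumˡ₃ : ∀ j a b c → ℤ.+ powerSumˡ j (a ∷ b ∷ c ∷ []) ≡ IntegerRoots.powerSum₃ j (ℤ.+ a) (ℤ.+ b) (ℤ.+ c)
pos-powerSumˡ₃ j a b c = trans (ℤₚ.pos-+ (a ^ j) _) (cong₂ ℤ._+_ (pos-^ a j) (pos-powerSumˡ₂ j b c))

powerSumˡ₁-pair : ∀ b c → powerSumˡ 1 (b ∷ c ∷ []) ≡ b + c
powerSumˡ₁-pair b c = cong₂ _+_ (*-identityʳ b) (trans (+-identityʳ _) (*-identityʳ c))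

pair-↭ : ∀ b′ c′ b c → powerSumˡ 1 (b′ ∷ c′ ∷ []) ≡ powerSumˡ 1 (b ∷ c ∷ []) →
         powerSumˡ 2 (b′ ∷ c′ ∷ []) ≡ powerSumˡ 2 (b ∷ c ∷ []) → (b′ ∷ c′ ∷ []) ↭ (b ∷ c ∷ [])
pair-↭ b′ c′ b c eq₁ eq₂ = arranged (Sum.map ℤₚ.+-injective ℤₚ.+-injective
                                       (IntegerRoots.root₂ (ℤ.+ b′) (ℤ.+ c′) (ℤ.+ b) (ℤ.+ c) (cast 1 eq₁) (cast 2 eq₂)))
  where
  cast : ∀ j → powerSumˡ j (b′ ∷ c′ ∷ []) ≡ powerSumˡ j (b ∷ c ∷ []) →
         IntegerRoots.powerSum₂ j (ℤ.+ b′) (ℤ.+ c′) ≡ IntegerRoots.powerSum₂ j (ℤ.+ b) (ℤ.+ c)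
  cast j eq = trans (sym (pos-powerSumˡ₂ j b′ c′)) (trans (cong ℤ.+_ eq) (pos-powerSumˡ₂ j b c))
  sum≡ : b′ + c′ ≡ b + c
  sum≡ = trans (sym (powerSumˡ₁-pair b′ c′)) (trans eq₁ (powerSumˡ₁-pair b c))
  arranged : b′ ≡ b ⊎ b′ ≡ c → (b′ ∷ c′ ∷ []) ↭ (b ∷ c ∷ [])
  arranged (inj₁ b′≡b) = ↭-reflexive (cong₂ (λ x y → x ∷ y ∷ []) b′≡b
                           (+-cancelˡ-≡ b c′ c (subst (λ x → x + c′ ≡ b + c) b′≡b sum≡)))
  arranged (inj₂ b′≡c) = ↭-trans (↭-reflexive (cong₂ (λ x y → x ∷ y ∷ []) b′≡c
                           (+-cancelˡ-≡ c c′ b (trans (subst (λ x → x + c′ ≡ b + c) b′≡c sum≡) (+-comm b c)))))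
                           (↭-swap c b ↭-refl)

rearranged : ∀ {x a b c : ℕ} → x ≡ a ⊎ x ≡ b ⊎ x ≡ c → ∃₂ λ y z → (a ∷ b ∷ c ∷ []) ↭ (x ∷ y ∷ z ∷ [])
rearranged {b = b} {c} (inj₁ refl) = b , c , ↭-refl
rearranged {a = a} {c = c} (inj₂ (inj₁ refl)) = a , c , ↭-swap a _ ↭-refl
rearranged {a = a} {b} (inj₂ (inj₂ refl)) = a , b , ↭-trans (↭-prep a (↭-swap b _ ↭-refl)) (↭-swap a _ ↭-refl)

triple-↭ : ∀ a′ b′ c′ a b c → powerSumˡ 1 (a′ ∷ b′ ∷ c′ ∷ []) ≡ powerSumˡ 1 (a ∷ b ∷ c ∷ []) →
           powerSumˡ 2 (a′ ∷ b′ ∷ c′ ∷ []) ≡ powerSumˡ 2 (a ∷ b ∷ c ∷ []) →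
           powerSumˡ 3 (a′ ∷ b′ ∷ c′ ∷ []) ≡ powerSumˡ 3 (a ∷ b ∷ c ∷ []) → (a′ ∷ b′ ∷ c′ ∷ []) ↭ (a ∷ b ∷ c ∷ [])
triple-↭ a′ b′ c′ a b c eq₁ eq₂ eq₃ =
  ↭-trans (↭-prep a′ (pair-↭ b′ c′ y z (rest≡ 1 eq₁) (rest≡ 2 eq₂))) (↭-sym a∷b∷c↭a′∷y∷z)
  where
  cast : ∀ j → powerSumˡ j (a′ ∷ b′ ∷ c′ ∷ []) ≡ powerSumˡ j (a ∷ b ∷ c ∷ []) →
         IntegerRoots.powerSum₃ j (ℤ.+ a′) (ℤ.+ b′) (ℤ.+ c′) ≡ IntegerRoots.powerSum₃ j (ℤ.+ a) (ℤ.+ b) (ℤ.+ c)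
  cast j eq = trans (sym (pos-powerSumˡ₃ j a′ b′ c′)) (trans (cong ℤ.+_ eq) (pos-powerSumˡ₃ j a b c))
  split : ∃₂ λ y z → (a ∷ b ∷ c ∷ []) ↭ (a′ ∷ y ∷ z ∷ [])
  split = rearranged (Sum.map ℤₚ.+-injective (Sum.map ℤₚ.+-injective ℤₚ.+-injective)
            (IntegerRoots.root₃ (ℤ.+ a′) (ℤ.+ b′) (ℤ.+ c′) (ℤ.+ a) (ℤ.+ b) (ℤ.+ c) (cast 1 eq₁) (cast 2 eq₂) (cast 3 eq₃)))
  y z : ℕ
  y = proj₁ split
  z = proj₁ (proj₂ split)
  a∷b∷c↭a′∷y∷z : (a ∷ b ∷ c ∷ []) ↭ (a′ ∷ y ∷ z ∷ [])
  a∷b∷c↭a′∷y∷z = proj₂ (proj₂ split)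
  rest≡ : ∀ j → powerSumˡ j (a′ ∷ b′ ∷ c′ ∷ []) ≡ powerSumˡ j (a ∷ b ∷ c ∷ []) →
          powerSumˡ j (b′ ∷ c′ ∷ []) ≡ powerSumˡ j (y ∷ z ∷ [])
  rest≡ j eq = +-cancelˡ-≡ (a′ ^ j) _ _ (trans eq (powerSumˡ-↭ j a∷b∷c↭a′∷y∷z))

pad : ∀ {k} → k ≤ 3 → (Fin k → ℕ) → Fin 3 → ℕ
pad {0} _ ℓ _ = 0
pad {1} _ ℓ 0F = ℓ 0F
pad {1} _ ℓ (suc _) = 0
pad {2} _ ℓ 0F = ℓ 0F
pad {2} _ ℓ 1F = ℓ 1F
pad {2} _ ℓ 2F = 0
pad {3} _ ℓ i = ℓ i
pad {suc (suc (suc (suc _)))} (s≤s (s≤s (s≤s ()))) _ _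

∑-pad : ∀ {k} (k≤3 : k ≤ 3) (ℓ : Fin k → ℕ) (f : ℕ → ℕ) → f 0 ≡ 0 → ∑[ c < k ] f (ℓ c) ≡ ∑[ i < 3 ] f (pad k≤3 ℓ i)
∑-pad {0} _ ℓ f f0≡0 rewrite f0≡0 = refl
∑-pad {1} _ ℓ f f0≡0 rewrite f0≡0 = refl
∑-pad {2} _ ℓ f f0≡0 rewrite f0≡0 = refl
∑-pad {3} _ ℓ f f0≡0 = refl
∑-pad {suc (suc (suc (suc _)))} (s≤s (s≤s (s≤s ()))) _ _ _

powerSums-determine-multiplicities :
  ∀ {k k′} → k ≤ 3 → k′ ≤ 3 → (ℓ : Fin k → ℕ) (ℓ′ : Fin k′ → ℕ) →
  powerSum ℓ 1 ≡ powerSum ℓ′ 1 → powerSum ℓ 2 ≡ powerSum ℓ′ 2 → powerSum ℓ 3 ≡ powerSum ℓ′ 3 →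
  ∀ v → 0 < v → multiplicity ℓ v ≡ multiplicity ℓ′ v
powerSums-determine-multiplicities {k} {k′} k≤3 k′≤3 ℓ ℓ′ eq₁ eq₂ eq₃ v 0<v = begin
  multiplicity ℓ v                         ≡⟨ sums-as-lists k≤3 ℓ count-v count-v-0 ⟩
  sumˡ (map count-v (tabulate padded))     ≡⟨ sum-↭ (map⁺ count-v (↭-sym padded′↭padded)) ⟩
  sumˡ (map count-v (tabulate padded′))    ≡⟨ sums-as-lists k′≤3 ℓ′ count-v count-v-0 ⟨
  multiplicity ℓ′ v                        ∎
  where
  open ≡-Reasoning
  padded padded′ : Fin 3 → ℕ
  padded = pad k≤3 ℓ
  padded′ = pad k′≤3 ℓ′
  sums-as-lists : ∀ {k} (k≤3 : k ≤ 3) (ℓ : Fin k → ℕ) (f : ℕ → ℕ) → f 0 ≡ 0 →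
                  ∑[ c < k ] f (ℓ c) ≡ sumˡ (map f (tabulate (pad k≤3 ℓ)))
  sums-as-lists k≤3 ℓ f f0≡0 = trans (∑-pad k≤3 ℓ f f0≡0) (sym (sumˡ-map-tabulate f (pad k≤3 ℓ)))
  count-v : ℕ → ℕ
  count-v x = 𝟙 (x ℕ.≟ v)
  count-v-0 : count-v 0 ≡ 0
  count-v-0 = 𝟙-no (0 ℕ.≟ v) (λ 0≡v → <-irrefl 0≡v 0<v)
  powerSums≡ : ∀ j → powerSum ℓ (suc j) ≡ powerSum ℓ′ (suc j) →
               powerSumˡ (suc j) (tabulate padded′) ≡ powerSumˡ (suc j) (tabulate padded)
  powerSums≡ j eq = trans (sym (sums-as-lists k′≤3 ℓ′ (_^ suc j) refl)) (trans (sym eq) (sums-as-lists k≤3 ℓ (_^ suc j) refl))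
  padded′↭padded : tabulate padded′ ↭ tabulate padded
  padded′↭padded = triple-↭ _ _ _ _ _ _ (powerSums≡ 0 eq₁) (powerSums≡ 1 eq₂) (powerSums≡ 2 eq₃)

-- Isomorphism from equal chain lengths

module Rank {m : ℕ} {S : Fin m → Set} (S? : ∀ x → Dec (S x))
            {_⊏_ : Rel (Fin m) 0ℓ} (_⊏?_ : Decidable _⊏_)
            (⊏-irrefl : ∀ {x} → ¬ x ⊏ x) (⊏-trans : ∀ {x y z} → x ⊏ y → y ⊏ z → x ⊏ z)
            (⊏-total : ∀ {x y} → S x → S y → x ≢ y → x ⊏ y ⊎ y ⊏ x) where

  rank : Fin m → ℕ
  rank x = ∑[ z < m ] 𝟙 (S? z ×-dec z ⊏? x)

  size : ℕ
  size = ∑[ z < m ] 𝟙 (S? z)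

  rank-mono : ∀ {x y} → S x → x ⊏ y → rank x < rank y
  rank-mono {x} {y} sx x⊏y = ∑-mono-< m
    (λ z → 𝟙-mono (λ (sz , z⊏x) → sz , ⊏-trans z⊏x x⊏y) (S? z ×-dec z ⊏? x) (S? z ×-dec z ⊏? y)) x
    (≤-<-trans (≤-reflexive (𝟙-no (S? x ×-dec x ⊏? x) (⊏-irrefl ∘ proj₂)))
               (≤-reflexive (sym (𝟙-yes (S? x ×-dec x ⊏? y) (sx , x⊏y)))))

  rank<size : ∀ {x} → S x → rank x < size
  rank<size {x} sx = ∑-mono-< m (λ z → 𝟙-mono proj₁ (S? z ×-dec z ⊏? x) (S? z)) x
    (≤-<-trans (≤-reflexive (𝟙-no (S? x ×-dec x ⊏? x) (⊏-irrefl ∘ proj₂))) (≤-reflexive (sym (𝟙-yes (S? x) sx))))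

  rank-injective : ∀ {x y} → S x → S y → rank x ≡ rank y → x ≡ y
  rank-injective {x} {y} sx sy rx≡ry with x Fin.≟ y
  ... | yes x≡y = x≡y
  ... | no x≢y with ⊏-total sx sy x≢y
  ...   | inj₁ x⊏y = contradiction rx≡ry (<⇒≢ (rank-mono sx x⊏y))
  ...   | inj₂ y⊏x = contradiction (sym rx≡ry) (<⇒≢ (rank-mono sy y⊏x))

  -- Every r < size is hit exactly once: the ranks of the size elements of S are distinct and below size.
  rank-surjective : ∀ {r} → r < size → ∃ λ x → S x × rank x ≡ r
  rank-surjective {r} r<size =
    let x , 0<hitsₓ = ∑-positive m (λ x → 𝟙 (hit? x (Fin.fromℕ< r<size)))
                        (≤-reflexive (sym (∑≡n⇒all≡1 size hits hits≤1 ∑-hits (Fin.fromℕ< r<size))))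
        sx , rank≡ = 𝟙-positive (hit? x (Fin.fromℕ< r<size)) 0<hitsₓ
    in x , sx , trans rank≡ (Finₚ.toℕ-fromℕ< r<size)
    where
    hit? : ∀ x (i : Fin size) → Dec (S x × rank x ≡ toℕ i)
    hit? x i = S? x ×-dec rank x ℕ.≟ toℕ i
    hits : Fin size → ℕ
    hits i = ∑[ x < m ] 𝟙 (hit? x i)
    hits≤1 : ∀ i → hits i ≤ 1
    hits≤1 i = ∑-𝟙-unique m (λ x → hit? x i) λ x y (sx , rx≡i) (sy , ry≡i) → rank-injective sx sy (trans rx≡i (sym ry≡i))
    hit-once : ∀ x → ∑[ i < size ] 𝟙 (hit? x i) ≡ 𝟙 (S? x)
    hit-once x = trans (sum-cong-≗ λ (i : Fin size) → 𝟙-× (S? x) (rank x ℕ.≟ toℕ i))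
                       (trans (sym (*-distribˡ-sum (𝟙 (S? x)) λ (i : Fin size) → 𝟙 (rank x ℕ.≟ toℕ i))) (by-membership (S? x)))
      where
      rank-hit-once : S x → ∑[ i < size ] 𝟙 (rank x ℕ.≟ toℕ i) ≡ 1
      rank-hit-once sx = trans (sum-cong-≗ λ i → 𝟙-⇔ (mk⇔ (λ eq → Finₚ.toℕ-injective (trans (Finₚ.toℕ-fromℕ< (rank<size sx)) eq))
                                                          (λ eq → trans (sym (Finₚ.toℕ-fromℕ< (rank<size sx))) (cong toℕ eq)))
                                                     (rank x ℕ.≟ toℕ i) (Fin.fromℕ< (rank<size sx) Fin.≟ i))
                               (∑-𝟙≟ (Fin.fromℕ< (rank<size sx)))
      by-membership : (sx? : Dec (S x)) → 𝟙 sx? * ∑[ i < size ] 𝟙 (rank x ℕ.≟ toℕ i) ≡ 𝟙 sx?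
      by-membership (yes sx) = trans (+-identityʳ _) (rank-hit-once sx)
      by-membership (no _) = refl
    ∑-hits : ∑[ i < size ] hits i ≡ size
    ∑-hits = trans (∑-comm (λ i x → 𝟙 (hit? x i))) (sum-cong-≗ hit-once)

isomorphic-via-codes : ∀ {K : Set} (_◁_ : K → K → Set) (P Q : FinPoset) →
  let open FinPoset P using () renaming (size to m; _<_ to _≺_)
      open FinPoset Q using () renaming (size to n; _<_ to _≺′_) in
  (κ : Fin m → K) (κ′ : Fin n → K) → (∀ {x y} → κ x ≡ κ y → x ≡ y) → (∀ {x y} → κ′ x ≡ κ′ y → x ≡ y) →
  (∀ x → ∃ λ y → κ′ y ≡ κ x) → (∀ y → ∃ λ x → κ x ≡ κ′ y) →
  (∀ x y → x ≺ y ⇔ κ x ◁ κ y) → (∀ x y → x ≺′ y ⇔ κ′ x ◁ κ′ y) → Isomorphic P Q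
isomorphic-via-codes _◁_ P Q κ κ′ κ-inj κ′-inj to from ≺⇔ ≺′⇔ = mk↔ₛ′ h g h∘g g∘h , λ x y →
  mk⇔ (λ x≺y → Equivalence.from (≺′⇔ (h x) (h y)) (subst₂ _◁_ (sym (h-code x)) (sym (h-code y)) (Equivalence.to (≺⇔ x y) x≺y)))
      (λ hx≺hy → Equivalence.from (≺⇔ x y) (subst₂ _◁_ (h-code x) (h-code y) (Equivalence.to (≺′⇔ (h x) (h y)) hx≺hy)))
  where
  h : Fin (FinPoset.size P) → Fin (FinPoset.size Q)
  h x = proj₁ (to x)
  h-code : ∀ x → κ′ (h x) ≡ κ x
  h-code x = proj₂ (to x)
  g : Fin (FinPoset.size Q) → Fin (FinPoset.size P)
  g y = proj₁ (from y)
  g-code : ∀ y → κ (g y) ≡ κ′ y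
  g-code y = proj₂ (from y)
  h∘g : ∀ y → h (g y) ≡ y
  h∘g y = κ′-inj (trans (h-code (g y)) (g-code y))
  g∘h : ∀ x → g (h x) ≡ x
  g∘h x = κ-inj (trans (g-code (h x)) (h-code x))

Fin-<-connex : ∀ {n} {i j : Fin n} → i ≢ j → i Fin.< j ⊎ j Fin.< i
Fin-<-connex {i = i} {j} i≢j with Finₚ.<-cmp i j
... | tri< i<j _ _ = inj₁ i<j
... | tri≈ _ i≡j _ = contradiction i≡j i≢j
... | tri> _ _ j<i = inj₂ j<i

Code : Set
Code = ℕ × ℕ × ℕ

_◁_ : Code → Code → Set
(v , i , r) ◁ (v′ , i′ , r′) = v ≡ v′ × i ≡ i′ × r < r′

module Codes (P : FinPoset) {k : ℕ} (chains : IsUnionOfChains P k) where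
  open FinPoset P renaming (size to n; _<_ to _≺_; _<?_ to _≺?_)
  open IsDecStrictPartialOrder isDSPO using (irrefl) renaming (trans to ≺-trans)
  open ChainUnion P chains

  module InChain (c : Fin k) = Rank (λ y → block y Fin.≟ c) _≺?_ (irrefl refl) ≺-trans
                                     (λ {x} {y} bx≡c by≡c x≢y → comparable x y x≢y (trans bx≡c (sym by≡c)))
  module AmongChains (v : ℕ) = Rank (λ d → blockSize d ℕ.≟ v) Finₚ._<?_ (λ {i} → <-irrefl {toℕ i} refl)
                                     (λ {i} {j} {l} → <-trans {toℕ i} {toℕ j} {toℕ l}) (λ _ _ → Fin-<-connex)

  chainRank : Fin n → ℕ
  chainRank x = InChain.rank (block x) x

  blockRank : Fin k → ℕ
  blockRank c = AmongChains.rank (blockSize c) c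

  -- (length of the chain of x, rank of that chain among chains of the same length, rank of x in its chain)
  code : Fin n → Code
  code x = blockSize (block x) , blockRank (block x) , chainRank x

  chainRank-mono : ∀ {x y} → x ≺ y → chainRank x < chainRank y
  chainRank-mono {x} {y} x≺y = subst (λ c → chainRank x < InChain.rank c y) (block-≺ x≺y) (InChain.rank-mono (block x) refl x≺y)

  blocks-injective : ∀ {c d} → blockSize c ≡ blockSize d → blockRank c ≡ blockRank d → c ≡ d
  blocks-injective {c} {d} size≡ rank≡ =
    AmongChains.rank-injective (blockSize c) refl (sym size≡) (trans rank≡ (cong (λ v → AmongChains.rank v d) (sym size≡)))

  code-injective : ∀ {x y} → code x ≡ code y → x ≡ y
  code-injective {x} {y} code≡ = InChain.rank-injective (block x) refl (sym same-block)
    (trans (cong (proj₂ ∘ proj₂) code≡) (cong (λ c → InChain.rank c y) (sym same-block)))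
    where
    same-block : block x ≡ block y
    same-block = blocks-injective (cong proj₁ code≡) (cong (proj₁ ∘ proj₂) code≡)

  ≺⇔◁ : ∀ x y → x ≺ y ⇔ code x ◁ code y
  ≺⇔◁ x y = mk⇔ (λ x≺y → cong blockSize (block-≺ x≺y) , cong blockRank (block-≺ x≺y) , chainRank-mono x≺y) from
    where
    from : code x ◁ code y → x ≺ y
    from (size≡ , rank≡ , rx<ry) with x Fin.≟ y
    ... | yes refl = contradiction rx<ry (<-irrefl refl)
    ... | no x≢y with comparable x y x≢y (blocks-injective size≡ rank≡)
    ...   | inj₁ x≺y = x≺y
    ...   | inj₂ y≺x = contradiction (chainRank-mono y≺x) (<-asym rx<ry)

  code-surjective : ∀ {v i r} → r < v → i < multiplicity blockSize v → ∃ λ x → code x ≡ (v , i , r)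
  code-surjective {v} {i} {r} r<v i<mult =
    let c , size≡v , rank≡i = AmongChains.rank-surjective v i<mult
        x , bx≡c , rank≡r = InChain.rank-surjective c (subst (r <_) (sym size≡v) r<v)
    in x , code≡ bx≡c size≡v rank≡i rank≡r
    where
    code≡ : ∀ {x c v i r} → block x ≡ c → blockSize c ≡ v → AmongChains.rank v c ≡ i → InChain.rank c x ≡ r →
            code x ≡ (v , i , r)
    code≡ refl refl rank≡i rank≡r = cong₂ _,_ refl (cong₂ _,_ rank≡i rank≡r)

  code-bounds : ∀ x → chainRank x < blockSize (block x) × blockRank (block x) < multiplicity blockSize (blockSize (block x))
  code-bounds x = InChain.rank<size (block x) refl , AmongChains.rank<size (blockSize (block x)) refl

isomorphic-if-same-chain-lengths : ∀ (P Q : FinPoset) {k k′} (chains : IsUnionOfChains P k) (chains′ : IsUnionOfChains Q k′) →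
  (∀ v → 0 < v → multiplicity (ChainUnion.blockSize P chains) v ≡ multiplicity (ChainUnion.blockSize Q chains′) v) →
  Isomorphic P Q
isomorphic-if-same-chain-lengths P Q chains chains′ same =
  isomorphic-via-codes _◁_ P Q CP.code CQ.code CP.code-injective CQ.code-injective
    (λ x → let r<v , i<mult = CP.code-bounds x in
           CQ.code-surjective r<v (subst (_ <_) (same _ (≤-<-trans z≤n r<v)) i<mult))
    (λ y → let r<v , i<mult = CQ.code-bounds y in
           CP.code-surjective r<v (subst (_ <_) (sym (same _ (≤-<-trans z≤n r<v))) i<mult))
    CP.≺⇔◁ CQ.≺⇔◁
  where
  module CP = Codes P chains
  module CQ = Codes Q chains′

mainTheorem13 : (P Q : FinPoset) → UnionOfAtMostThreeChains P → UnionOfAtMostThreeChains Q →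
    U-eq P Q → Isomorphic P Q
mainTheorem13 P Q (k , k≤3 , chains) (k′ , k′≤3 , chains′) P≡Q =
  isomorphic-if-same-chain-lengths P Q chains chains′
    (powerSums-determine-multiplicities k≤3 k′≤3 CP.blockSize CQ.blockSize p₁≡ p₂≡ p₃≡)
  where
  module CP = ChainUnion P chains
  module CQ = ChainUnion Q chains′
  size≡ : FinPoset.size P ≡ FinPoset.size Q
  size≡ = ≡U⇒size≡ (D P) (D Q) P≡Q
  relations≡ : relationCount P ≡ relationCount Q
  relations≡ = proj₁ (U-eq⇒counts≡ P Q P≡Q)
  chains≡ : chainCount P ≡ chainCount Q
  chains≡ = proj₂ (U-eq⇒counts≡ P Q P≡Q)
  p₁≡ : powerSum CP.blockSize 1 ≡ powerSum CQ.blockSize 1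
  p₁≡ = trans CP.powerSum₁-blockSize (trans size≡ (sym CQ.powerSum₁-blockSize))
  p₂≡ : powerSum CP.blockSize 2 ≡ powerSum CQ.blockSize 2
  p₂≡ = trans CP.powerSum₂-blockSize (trans (cong₂ (λ n A → n + (A + A)) size≡ relations≡) (sym CQ.powerSum₂-blockSize))
  p₃≡ : powerSum CP.blockSize 3 ≡ powerSum CQ.blockSize 3
  p₃≡ = trans CP.powerSum₃-blockSize
          (trans (cong₂ (λ n (AC : ℕ × ℕ) → n + 6 * proj₁ AC + 6 * proj₂ AC) size≡ (cong₂ _,_ relations≡ chains≡))
                 (sym CQ.powerSum₃-blockSize))
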